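{- Let $r,n$ be positive integers. For every region $\Delta$ of the $r$-Catalan arrangement $\mathcal{C}_n^r$ with $\pi_\Delta$ the identity, and any ${\bm x}\in\Delta$, the sequence ${\bm h}(\Delta)=(h_1(\Delta),\ldots,h_n(\Delta))$ is independent of ${\bm x}$ and is the height sequence of an $r$-Dyck path $P_\Delta$ of length $n$. For a general region $\Delta$, set $P_\Delta:=P_{\pi_\Delta(\Delta)}$. Then the map \[\Phi_n^r:\mathcal{R}(\mathcal{C}_n^r)\to\mathfrak{S}_n\times\mathcal{D}_n^r,\qquad \Phi_n^r(\Delta)=(\pi_\Delta,P_\Delta)\] is a bijection.
   Context: The $r$-Catalan arrangement $\mathcal{C}_n^r$ in $\mathbb{R}^n$ consists of the hyperplanes $x_i-x_j=a$ for $1\le i<j\le n$ and $a\in\{0,\pm1,\ldots,\pm r\}$. Its regions are the connected components of the complement of the union of these hyperplanes, and $\mathcal{R}(\mathcal{C}_n^r)$ is the set of regions. The symmetric group $\mathfrak{S}_n$ acts on $\mathbb{R}^n$ by $\pi({\bm x})=(x_{\pi(1)},\ldots,x_{\pi(n)})$, and this action permutes the regions. For a region $\Delta$, $\pi_\Delta\in\mathfrak{S}_n$ is the unique permutation with $x_{\pi_\Delta(1)}>\cdots>x_{\pi_\Delta(n)}$ for ${\bm x}\in\Delta$. Thus $\pi_\Delta(\Delta)$ is a region on which $x_1>\cdots>x_n$. For ${\bm x}\in\mathbb{R}^n$, let $d_{ijk}({\bm x})=x_i-x_j-k$ if $i\ne j$ and $d_{ijk}({\bm x})=0$ if $i=j$,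 for $i,j\in[n]$ and $k\in[r]$. For $\Delta$ with $\pi_\Delta$ the identity and ${\bm x}\in\Delta$, $h_j(\Delta)$ is the number of pairs $(i,k)\in[n]\times[r]$ with $d_{ijk}({\bm x})>0$. An $r$-Dyck path of length $n$ is a lattice path from $(0,0)$ to $(n,rn)$ with steps $(1,0)$ and $(0,1)$ never going above the line $y=rx$. $\mathcal{D}_n^r$ is the set of such paths. The height sequence of such a path $P$ is $(h_1(P),\ldots,h_n(P))$, where $h_i(P)$ is the $y$-coordinate at which the vertical line $x=i-\frac12$ meets $P$.
   Formalization: The points ${\bm x}$ representing regions of $\mathcal{C}_n^r$ have rational coordinates, lying in ℚ^n instead of ℝ^n. -}

module Defs where

open import Data.Nat as ℕ using (ℕ; zero; suc; _≤_)
open import Data.Integer as ℤ using (ℤ; +_)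
open import Data.Rational using (ℚ; _/_; _-_; _<_; _>_; 0ℚ)
open import Data.Rational.Properties using (_<?_)
open import Data.Fin using (Fin; _≟_)
import Data.Fin as F
open import Data.List using (List; []; _∷_; length; filter; map; allFin; upTo; cartesianProduct; take; tabulate)
open import Data.Product using (_×_; _,_)
open import Data.Fin.Permutation using (Permutation′; _⟨$⟩ʳ_)
open import Relation.Nullary using (¬_; yes; no)
open import Relation.Binary.PropositionalEquality using (_≡_; _≢_)
open import Function using (_⇔_)

Point : ℕ → Set
Point n = Fin n → ℚ

ℤ→ℚ : ℤ → ℚ
ℤ→ℚ a = a / 1

InComplement : (r n : ℕ) → Point n → Set
InComplement r n x =
  ∀ (i j : Fin n) → i F.< j → ∀ (a : ℤ) → ℤ.∣ a ∣ ≤ r → x i - x j ≢ ℤ→ℚ a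

-- x and y lie on the same side of every hyperplane of 𝒞_n^r
-- (for points of the complement: they lie in the same region)
SameRegion : (r n : ℕ) → Point n → Point n → Set
SameRegion r n x y =
  ∀ (i j : Fin n) → i F.< j → ∀ (a : ℤ) → ℤ.∣ a ∣ ≤ r →
    (x i - x j < ℤ→ℚ a) ⇔ (y i - y j < ℤ→ℚ a)

Sorts : {n : ℕ} → Permutation′ n → Point n → Set
Sorts {n} σ x = ∀ (a b : Fin n) → a F.< b → x (σ ⟨$⟩ʳ a) > x (σ ⟨$⟩ʳ b)

act : {n : ℕ} → Permutation′ n → Point n → Point n
act σ x i = x (σ ⟨$⟩ʳ i)

d : {n : ℕ} → Point n → Fin n → Fin n → ℕ → ℚ
d x i j k with i ≟ j
... | yes _ = 0ℚ
... | no  _ = x i - x j - ℤ→ℚ (+ k)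

range1 : ℕ → List ℕ
range1 r = map suc (upTo r)

h : (r : ℕ) {n : ℕ} → Point n → Fin n → ℕ
h r {n} x j = length (filter (λ p → 0ℚ <? d x (Data.Product.proj₁ p) j (Data.Product.proj₂ p))
                             (cartesianProduct (allFin n) (range1 r)))

hseq : (r : ℕ) {n : ℕ} → Point n → List ℕ
hseq r x = tabulate (h r x)

-- lattice paths: E = (1,0), N = (0,1)
data Step : Set where
  E N : Step

Path : Set
Path = List Step

countE : Path → ℕ
countE [] = 0
countE (E ∷ s) = suc (countE s)
countE (N ∷ s) = countE s

countN : Path → ℕ
countN [] = 0
countN (E ∷ s) = countN s
countN (N ∷ s) = suc (countN s)

IsDyck : (r n : ℕ) → Path → Set
IsDyck r n P =
  (countE P ≡ n) × (countN P ≡ r ℕ.* n) ×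
  (∀ m → countN (take m P) ≤ r ℕ.* countE (take m P))

heightsFrom : ℕ → Path → List ℕ
heightsFrom c [] = []
heightsFrom c (E ∷ s) = c ∷ heightsFrom c s
heightsFrom c (N ∷ s) = heightsFrom (suc c) s

heights : Path → List ℕ
heights = heightsFrom 0

{-# OPTIONS --safe #-}

-- For x off the arrangement, the region of x is determined by the relative order of the numbers
-- x_a + k (0 ≤ k ≤ r), and h_j(x) counts the markers x_i - k (1 ≤ k ≤ r) lying above x_j.  When
-- x is decreasing, markers above x_j come from earlier points and stay above later ones, so h is
-- weakly increasing with h_j ≤ r(j-1): a Dyck height sequence.  Conversely h determines the order
-- by induction on the points, the new point being compared with the old ones through a counting
-- (exchange) argument.  Every Dyck height sequence is realised by placing the points one by one
-- on finer and finer dyadic grids, using a discrete intermediate value argument for each.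
module Submission where

open import Defs

module Counting where

  open import Level using (0ℓ)
  open import Data.Nat using (ℕ; zero; suc; _+_; _*_; _≤_; _<_; _<?_; z≤n; s≤s; s≤s⁻¹)
  open import Data.Nat.Properties
    using (≤-trans; ≤-antisym; <⇒≢; ≤-reflexive; m≤n⇒m≤1+n; n≤1+n; +-monoʳ-≤; +-suc)
  open import Data.Fin using (Fin; toℕ)
  import Data.Fin as Fin
  open import Data.List using (List; []; _∷_; length; filter; map; _++_; cartesianProduct; allFin)
  open import Data.List.Properties using (filter-all; filter-none; filter-++; length-++; map-tabulate)
  open import Data.List.Relation.Unary.All as All using (All; []; _∷_)
  open import Data.List.Relation.Unary.All.Properties using (¬Any⇒All¬)
  open import Data.List.Relation.Unary.Any using (here; there; any?)
  open import Data.List.Relation.Unary.Unique.Propositional using (Unique)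
  open import Data.List.Relation.Unary.AllPairs using ([]; _∷_)
  open import Data.List.Membership.Propositional using (_∈_; find)
  open import Data.Product using (_×_; _,_; ∃-syntax; proj₁)
  open import Data.Sum using (_⊎_; inj₁; inj₂)
  open import Function using (_∘_)
  open import Relation.Nullary using (¬_; yes; no; contradiction)
  open import Relation.Nullary.Decidable using (_×-dec_; ¬?; decidable-stable)
  open import Relation.Unary using (Pred; Decidable)
  open import Relation.Binary.PropositionalEquality using (_≡_; refl; sym; cong; cong₂; subst; module ≡-Reasoning)

  private
    variable
      A B : Set

  module _ {A : Set} where
    private
      variable
        P Q R : Pred A 0ℓ
        x : A
        xs : List A

    count : Decidable P → List A → ℕ
    count P? xs = length (filter P? xs)

    count-mono : (P? : Decidable P) (Q? : Decidable Q) →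
                 All (λ x → P x → Q x) xs → count P? xs ≤ count Q? xs
    count-mono P? Q? [] = z≤n
    count-mono {xs = x ∷ _} P? Q? (f ∷ fs) with P? x | Q? x
    ... | yes p | yes _ = s≤s (count-mono P? Q? fs)
    ... | yes p | no ¬q = contradiction (f p) ¬q
    ... | no _  | yes _ = m≤n⇒m≤1+n (count-mono P? Q? fs)
    ... | no _  | no _  = count-mono P? Q? fs

    count-< : (P? : Decidable P) (Q? : Decidable Q) → All (λ x → P x → Q x) xs →
              x ∈ xs → Q x → ¬ P x → count P? xs < count Q? xs
    count-< {xs = x ∷ _} P? Q? (f ∷ fs) (here refl) qx ¬px with P? x | Q? x
    ... | yes px | _     = contradiction px ¬px
    ... | no _   | yes _ = s≤s (count-mono P? Q? fs)
    ... | no _   | no ¬q = contradiction qx ¬q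
    count-< {xs = y ∷ _} P? Q? (f ∷ fs) (there x∈) qx ¬px with P? y | Q? y
    ... | yes p | yes _ = s≤s (count-< P? Q? fs x∈ qx ¬px)
    ... | yes p | no ¬q = contradiction (f p) ¬q
    ... | no _  | yes _ = m≤n⇒m≤1+n (count-< P? Q? fs x∈ qx ¬px)
    ... | no _  | no _  = count-< P? Q? fs x∈ qx ¬px

    count-cong : (P? : Decidable P) (Q? : Decidable Q) → All (λ x → P x → Q x) xs →
                 All (λ x → Q x → P x) xs → count P? xs ≡ count Q? xs
    count-cong P? Q? P⇒Q Q⇒P = ≤-antisym (count-mono P? Q? P⇒Q) (count-mono Q? P? Q⇒P)

    count-exchange : (P? : Decidable P) (Q? : Decidable Q) → count P? xs ≡ count Q? xs →
                     x ∈ xs → P x → ¬ Q x → ∃[ y ] y ∈ xs × Q y × ¬ P y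
    count-exchange {P = P} {Q} {xs = xs} P? Q? eq x∈ px ¬qx with any? (λ y → Q? y ×-dec ¬? (P? y)) xs
    ... | yes found = find found
    ... | no none = contradiction (sym eq) (<⇒≢ (count-< Q? P? Q⇒P x∈ px ¬qx))
      where
      Q⇒P : All (λ y → Q y → P y) xs
      Q⇒P = All.map (λ ¬[q×¬p] q → decidable-stable (P? _) (λ ¬p → ¬[q×¬p] (q , ¬p))) (¬Any⇒All¬ xs none)

    count-∪ : (P? : Decidable P) (Q? : Decidable Q) (R? : Decidable R) →
              All (λ x → Q x → P x ⊎ R x) xs → count Q? xs ≤ count P? xs + count R? xs
    count-∪ P? Q? R? [] = z≤n
    count-∪ {xs = x ∷ xs} P? Q? R? (f ∷ fs) with Q? x | P? x | R? x | count-∪ P? Q? R? fs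
    ... | no _  | yes _ | yes _ | ih = m≤n⇒m≤1+n (≤-trans ih (+-monoʳ-≤ (count P? xs) (n≤1+n _)))
    ... | no _  | yes _ | no _  | ih = m≤n⇒m≤1+n ih
    ... | no _  | no _  | yes _ | ih = ≤-trans ih (+-monoʳ-≤ (count P? xs) (n≤1+n _))
    ... | no _  | no _  | no _  | ih = ih
    ... | yes _ | yes _ | yes _ | ih = s≤s (≤-trans ih (+-monoʳ-≤ (count P? xs) (n≤1+n _)))
    ... | yes _ | yes _ | no _  | ih = s≤s ih
    ... | yes _ | no _  | yes _ | ih = subst (suc (count Q? xs) ≤_) (sym (+-suc (count P? xs) (count R? xs))) (s≤s ih)
    ... | yes q | no ¬p | no ¬r | _ with f q
    ...   | inj₁ p = contradiction p ¬p
    ...   | inj₂ r = contradiction r ¬r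

    count-none : (P? : Decidable P) → All (¬_ ∘ P) xs → count P? xs ≡ 0
    count-none P? none = cong length (filter-none P? none)

    count-all : (P? : Decidable P) → All P xs → count P? xs ≡ length xs
    count-all P? all = cong length (filter-all P? all)

    count-≤1 : (P? : Decidable P) → Unique xs →
               (∀ {x y} → x ∈ xs → y ∈ xs → P x → P y → x ≡ y) → count P? xs ≤ 1
    count-≤1 P? [] _ = z≤n
    count-≤1 {xs = x ∷ xs} P? (x∉xs ∷ unique) P-unique with P? x
    ... | yes px = s≤s (≤-reflexive (count-none P? (All.tabulate λ y∈ py →
                     All.lookup x∉xs y∈ (P-unique (here refl) (there y∈) px py))))
    ... | no _ = count-≤1 P? unique (λ x∈ y∈ → P-unique (there x∈) (there y∈))

  count-map : {P : Pred B 0ℓ} (P? : Decidable P) (f : A → B) (xs : List A) →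
              count P? (map f xs) ≡ count (P? ∘ f) xs
  count-map P? f [] = refl
  count-map P? f (x ∷ xs) with P? (f x)
  ... | yes _ = cong suc (count-map P? f xs)
  ... | no _  = count-map P? f xs

  count-cartesianProduct : {P : Pred A 0ℓ} (P? : Decidable P) (xs : List A) (ys : List B) →
                           count (P? ∘ proj₁) (cartesianProduct xs ys) ≡ count P? xs * length ys
  count-cartesianProduct P? [] ys = refl
  count-cartesianProduct P? (x ∷ xs) ys = begin
    count (P? ∘ proj₁) (map (x ,_) ys ++ cartesianProduct xs ys)
      ≡⟨ cong length (filter-++ (P? ∘ proj₁) (map (x ,_) ys) _) ⟩
    length (filter (P? ∘ proj₁) (map (x ,_) ys) ++ filter (P? ∘ proj₁) (cartesianProduct xs ys))
      ≡⟨ length-++ (filter (P? ∘ proj₁) (map (x ,_) ys)) ⟩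
    count (P? ∘ proj₁) (map (x ,_) ys) + count (P? ∘ proj₁) (cartesianProduct xs ys)
      ≡⟨ cong₂ _+_ (count-map (P? ∘ proj₁) (x ,_) ys) (count-cartesianProduct P? xs ys) ⟩
    count (λ _ → P? x) ys + count P? xs * length ys
      ≡⟨ first-row ⟩
    count P? (x ∷ xs) * length ys ∎
    where
    open ≡-Reasoning
    first-row : count (λ _ → P? x) ys + count P? xs * length ys ≡ count P? (x ∷ xs) * length ys
    first-row with P? x
    ... | yes px = cong (_+ _) (count-all (λ _ → yes px) (All.universal (λ _ → px) ys))
    ... | no ¬px = cong (_+ _) (count-none (λ _ → no ¬px) (All.universal (λ _ → ¬px) ys))

  count-toℕ< : ∀ {n} j → j ≤ n → count (λ (i : Fin n) → toℕ i <? j) (allFin n) ≡ j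
  count-toℕ< {n} zero _ = count-none (λ i → toℕ i <? 0) (All.universal (λ _ ()) (allFin n))
  count-toℕ< {suc n} (suc j) (s≤s j≤n) = cong suc (begin
    count (λ i → toℕ i <? suc j) (Data.List.tabulate {n = n} Fin.suc)
      ≡⟨ cong (count (λ i → toℕ i <? suc j)) (sym (map-tabulate {n = n} (λ i → i) Fin.suc)) ⟩
    count (λ i → toℕ i <? suc j) (map Fin.suc (allFin n))
      ≡⟨ count-map (λ i → toℕ i <? suc j) Fin.suc (allFin n) ⟩
    count (λ i → suc (toℕ i) <? suc j) (allFin n)
      ≡⟨ count-cong (λ i → suc (toℕ i) <? suc j) (λ i → toℕ i <? j)
                    (All.universal (λ _ → s≤s⁻¹) (allFin n)) (All.universal (λ _ → s≤s) (allFin n)) ⟩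
    count (λ i → toℕ i <? j) (allFin n)
      ≡⟨ count-toℕ< j j≤n ⟩
    j ∎)
    where open ≡-Reasoning

module Arithmetic where

  open import Data.Nat as ℕ using (ℕ)
  open import Data.Integer as ℤ using (ℤ; +0; +[1+_]; -[1+_]; _⊖_)
  import Data.Integer.Properties as ℤ
  open import Data.Rational
    using (ℚ; mkℚ; _+_; _-_; -_; _*_; 1/_; _<_; _≤_; 0ℚ; 1ℚ; Positive; NonNegative; NonZero; *<*; *≤*)
  import Data.Rational.Properties as ℚ
  open import Data.Rational.Solver using (module +-*-Solver)
  import Data.Nat.Coprimality as Coprime
  open import Function using (_∘_; _⇔_; mk⇔; Equivalence)
  import Function.Properties.Equivalence as ⇔
  open import Relation.Nullary using (¬_; contradiction)
  open import Relation.Binary.Definitions using (tri<; tri≈; tri>)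
  open import Relation.Binary.PropositionalEquality
    using (_≡_; _≢_; refl; cong; cong₂; subst₂; sym; trans; module ≡-Reasoning)

  open +-*-Solver using (solve; _:+_; _:-_; :-_; _:*_; _:=_; con)

  ι : ℕ → ℚ
  ι k = ℤ→ℚ (ℤ.+ k)

  ℤ→ℚ≡mkℚ : ∀ a → ℤ→ℚ a ≡ mkℚ a 0 (Coprime.sym (Coprime.1-coprimeTo _))
  ℤ→ℚ≡mkℚ a = ℚ.↥p/↧p≡p (mkℚ a 0 (Coprime.sym (Coprime.1-coprimeTo _)))

  ℤ→ℚ-+ : ∀ a b → ℤ→ℚ (a ℤ.+ b) ≡ ℤ→ℚ a + ℤ→ℚ b
  ℤ→ℚ-+ a b rewrite ℤ→ℚ≡mkℚ a | ℤ→ℚ≡mkℚ b | ℤ.*-identityʳ a | ℤ.*-identityʳ b = refl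

  ℤ→ℚ-* : ∀ a b → ℤ→ℚ (a ℤ.* b) ≡ ℤ→ℚ a * ℤ→ℚ b
  ℤ→ℚ-* a b rewrite ℤ→ℚ≡mkℚ a | ℤ→ℚ≡mkℚ b = refl

  ℤ→ℚ-neg : ∀ a → ℤ→ℚ (ℤ.- a) ≡ - ℤ→ℚ a
  ℤ→ℚ-neg a rewrite ℤ→ℚ≡mkℚ (ℤ.- a) | ℤ→ℚ≡mkℚ a with a
  ... | +0       = refl
  ... | +[1+ _ ] = refl
  ... | -[1+ _ ] = refl

  ℤ→ℚ-⊖ : ∀ m n → ℤ→ℚ (m ⊖ n) ≡ ι m - ι n
  ℤ→ℚ-⊖ m n = begin
    ℤ→ℚ (m ⊖ n)                ≡⟨ cong ℤ→ℚ (sym (ℤ.m-n≡m⊖n m n)) ⟩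
    ℤ→ℚ (ℤ.+ m ℤ.+ ℤ.- ℤ.+ n)  ≡⟨ ℤ→ℚ-+ (ℤ.+ m) (ℤ.- ℤ.+ n) ⟩
    ι m + ℤ→ℚ (ℤ.- ℤ.+ n)      ≡⟨ cong (ι m +_) (ℤ→ℚ-neg (ℤ.+ n)) ⟩
    ι m - ι n                  ∎
    where open ≡-Reasoning

  ℤ→ℚ-mono-< : ∀ {a b} → a ℤ.< b → ℤ→ℚ a < ℤ→ℚ b
  ℤ→ℚ-mono-< {a} {b} a<b rewrite ℤ→ℚ≡mkℚ a | ℤ→ℚ≡mkℚ b =
    *<* (subst₂ ℤ._<_ (sym (ℤ.*-identityʳ a)) (sym (ℤ.*-identityʳ b)) a<b)

  ℤ→ℚ-mono-≤ : ∀ {a b} → a ℤ.≤ b → ℤ→ℚ a ≤ ℤ→ℚ b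
  ℤ→ℚ-mono-≤ {a} {b} a≤b rewrite ℤ→ℚ≡mkℚ a | ℤ→ℚ≡mkℚ b =
    *≤* (subst₂ ℤ._≤_ (sym (ℤ.*-identityʳ a)) (sym (ℤ.*-identityʳ b)) a≤b)

  ℤ→ℚ-cancel-< : ∀ {a b} → ℤ→ℚ a < ℤ→ℚ b → a ℤ.< b
  ℤ→ℚ-cancel-< {a} {b} a<b rewrite ℤ→ℚ≡mkℚ a | ℤ→ℚ≡mkℚ b =
    subst₂ ℤ._<_ (ℤ.*-identityʳ a) (ℤ.*-identityʳ b) (ℚ.drop-*<* a<b)

  ι-+ : ∀ m n → ι (m ℕ.+ n) ≡ ι m + ι n
  ι-+ m n = trans (cong ℤ→ℚ (ℤ.pos-+ m n)) (ℤ→ℚ-+ (ℤ.+ m) (ℤ.+ n))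

  ι-* : ∀ m n → ι (m ℕ.* n) ≡ ι m * ι n
  ι-* m n = trans (cong ℤ→ℚ (ℤ.pos-* m n)) (ℤ→ℚ-* (ℤ.+ m) (ℤ.+ n))

  ι-mono-< : ∀ {m n} → m ℕ.< n → ι m < ι n
  ι-mono-< m<n = ℤ→ℚ-mono-< (ℤ.+<+ m<n)

  ι-mono-≤ : ∀ {m n} → m ℕ.≤ n → ι m ≤ ι n
  ι-mono-≤ m≤n = ℤ→ℚ-mono-≤ (ℤ.+≤+ m≤n)

  ι-cancel-< : ∀ {m n} → ι m < ι n → m ℕ.< n
  ι-cancel-< {m} {n} ιm<ιn with ℤ.+<+ m<n ← ℤ→ℚ-cancel-< {ℤ.+ m} {ℤ.+ n} ιm<ιn = m<n

  p+c-c≡p : ∀ p c → p + c - c ≡ p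
  p+c-c≡p = solve 2 (λ p c → p :+ c :- c := p) refl

  +-cancelʳ-< : ∀ c {p q} → p + c < q + c → p < q
  +-cancelʳ-< c {p} {q} = subst₂ _<_ (p+c-c≡p p c) (p+c-c≡p q c) ∘ ℚ.+-monoˡ-< (- c)

  ≢∧≯⇒< : ∀ {p q} → p ≢ q → ¬ q < p → p < q
  ≢∧≯⇒< {p} {q} p≢q q≮p with ℚ.<-cmp p q
  ... | tri< p<q _ _ = p<q
  ... | tri≈ _ p≡q _ = contradiction p≡q p≢q
  ... | tri> _ _ q<p = contradiction q<p q≮p

  <-translate : ∀ c {p q p′ q′} → p + c ≡ p′ → q + c ≡ q′ → p < q ⇔ p′ < q′
  <-translate c p+c≡p′ q+c≡q′ = mk⇔
    (λ p<q → subst₂ _<_ p+c≡p′ q+c≡q′ (ℚ.+-monoˡ-< c p<q))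
    (λ p′<q′ → +-cancelʳ-< c (subst₂ _<_ (sym p+c≡p′) (sym q+c≡q′) p′<q′))

  ≡-translate : ∀ c {p q p′ q′} → p + c ≡ p′ → q + c ≡ q′ → p ≡ q ⇔ p′ ≡ q′
  ≡-translate c p+c≡p′ q+c≡q′ = mk⇔
    (λ p≡q → trans (sym p+c≡p′) (trans (cong (_+ c) p≡q) q+c≡q′))
    (λ p′≡q′ → trans (sym (p+c-c≡p _ c))
                 (trans (cong (_- c) (trans p+c≡p′ (trans p′≡q′ (sym q+c≡q′)))) (p+c-c≡p _ c)))

  p-q<s-t⇔p+t<q+s : ∀ p q s t → p - q < s - t ⇔ p + t < q + s
  p-q<s-t⇔p+t<q+s p q s t = <-translate (q + t)
    (solve 3 (λ p q t → (p :- q) :+ (q :+ t) := p :+ t) refl p q t)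
    (solve 3 (λ s q t → (s :- t) :+ (q :+ t) := q :+ s) refl s q t)

  p-q≡s-t⇔p+t≡q+s : ∀ p q s t → p - q ≡ s - t ⇔ p + t ≡ q + s
  p-q≡s-t⇔p+t≡q+s p q s t = ≡-translate (q + t)
    (solve 3 (λ p q t → (p :- q) :+ (q :+ t) := p :+ t) refl p q t)
    (solve 3 (λ s q t → (s :- t) :+ (q :+ t) := q :+ s) refl s q t)

  0<p-q-s⇔q+s<p+0 : ∀ p q s → 0ℚ < p - q - s ⇔ q + s < p + 0ℚ
  0<p-q-s⇔q+s<p+0 p q s = <-translate (q + s)
    (solve 2 (λ q s → con 0ℚ :+ (q :+ s) := q :+ s) refl q s)
    (solve 3 (λ p q s → (p :- q :- s) :+ (q :+ s) := p :+ con 0ℚ) refl p q s)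

  p+ιk<p+ιk′⇔k<k′ : ∀ p k k′ → p + ι k < p + ι k′ ⇔ k ℕ.< k′
  p+ιk<p+ιk′⇔k<k′ p k k′ = mk⇔
    (λ lt → ι-cancel-< (Equivalence.from (<-translate p (ℚ.+-comm (ι k) p) (ℚ.+-comm (ι k′) p)) lt))
    (λ lt → ℚ.+-monoʳ-< p (ι-mono-< lt))

  shift-cancel : ∀ p q m n s → p + ι (m ℕ.+ s) < q + ι (n ℕ.+ s) ⇔ p + ι m < q + ι n
  shift-cancel p q m n s = ⇔.sym (<-translate (ι s) (shift p m) (shift q n))
    where
    shift : ∀ p m → p + ι m + ι s ≡ p + ι (m ℕ.+ s)
    shift p m = trans (ℚ.+-assoc p (ι m) (ι s)) (cong (p +_) (sym (ι-+ m s)))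

  shift-trans : ∀ {a b c s t u} → a + u ≤ b + t → b + s < c + u → a + s < c + t
  shift-trans {a} {b} {c} {s} {t} {u} a+u≤b+t b+s<c+u = +-cancelʳ-< u (begin-strict
    a + s + u   ≡⟨ solve 3 (λ a s u → a :+ s :+ u := a :+ u :+ s) refl a s u ⟩
    a + u + s   ≤⟨ ℚ.+-monoˡ-≤ s a+u≤b+t ⟩
    b + t + s   ≡⟨ solve 3 (λ b s t → b :+ t :+ s := b :+ s :+ t) refl b s t ⟩
    b + s + t   <⟨ ℚ.+-monoˡ-< t b+s<c+u ⟩
    c + u + t   ≡⟨ solve 3 (λ c t u → c :+ u :+ t := c :+ t :+ u) refl c t u ⟩
    c + t + u   ∎)
    where open ℚ.≤-Reasoning

  module _ (U : ℕ) .{{_ : ℕ.NonZero U}} where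

    private
      instance
        ιU-positive : Positive (ι U)
        ιU-positive = ℚ.normalize-pos U 1
        ιU-nonZero : NonZero (ι U)
        ιU-nonZero = ℚ.pos⇒nonZero (ι U)
        ιU-nonNegative : NonNegative (ι U)
        ιU-nonNegative = ℚ.pos⇒nonNeg (ι U)

    scaled : ℕ → ℚ
    scaled A = - (ι A * 1/ ι U)

    private
      scaled+ι*U : ∀ A k → (scaled A + ι k) * ι U ≡ - ι A + ι (k ℕ.* U)
      scaled+ι*U A k = begin
        (- (ι A * 1/ ι U) + ι k) * ι U
          ≡⟨ solve 4 (λ a q w k → (:- (a :* q) :+ k) :* w := :- (a :* (q :* w)) :+ k :* w) refl (ι A) (1/ ι U) (ι U) (ι k) ⟩
        - (ι A * (1/ ι U * ι U)) + ι k * ι U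
          ≡⟨ cong₂ (λ q w → - (ι A * q) + w) (ℚ.*-inverseˡ (ι U)) (sym (ι-* k U)) ⟩
        - (ι A * 1ℚ) + ι (k ℕ.* U)
          ≡⟨ cong (λ a → - a + ι (k ℕ.* U)) (ℚ.*-identityʳ (ι A)) ⟩
        - ι A + ι (k ℕ.* U) ∎
        where open ≡-Reasoning

    scaled-below⇔ : ∀ A B k k′ → scaled A + ι k < scaled B + ι k′ ⇔ B ℕ.+ k ℕ.* U ℕ.< A ℕ.+ k′ ℕ.* U
    scaled-below⇔ A B k k′ = mk⇔
      (ι-cancel-< ∘ Equivalence.to translated
         ∘ subst₂ _<_ (scaled+ι*U A k) (scaled+ι*U B k′) ∘ ℚ.*-monoˡ-<-pos (ι U))
      (ℚ.*-cancelʳ-<-nonNeg (ι U) ∘ subst₂ _<_ (sym (scaled+ι*U A k)) (sym (scaled+ι*U B k′))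
         ∘ Equivalence.from translated ∘ ι-mono-<)
      where
      translated : - ι A + ι (k ℕ.* U) < - ι B + ι (k′ ℕ.* U) ⇔ ι (B ℕ.+ k ℕ.* U) < ι (A ℕ.+ k′ ℕ.* U)
      translated = <-translate (ι A + ι B)
        (trans (solve 3 (λ a b x → (:- a :+ x) :+ (a :+ b) := b :+ x) refl (ι A) (ι B) (ι (k ℕ.* U)))
               (sym (ι-+ B (k ℕ.* U))))
        (trans (solve 3 (λ a b y → (:- b :+ y) :+ (a :+ b) := a :+ y) refl (ι A) (ι B) (ι (k′ ℕ.* U)))
               (sym (ι-+ A (k′ ℕ.* U))))

module Regions where

  open Arithmetic
  open Counting
  open import Data.Nat as ℕ using (ℕ; suc; z≤n; s≤s)
  import Data.Nat.Properties as ℕ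
  open import Data.Integer as ℤ using (ℤ; +_; -[1+_]; _⊖_)
  import Data.Integer.Properties as ℤ
  open import Data.Rational using (ℚ; _+_; _-_; _<_; 0ℚ)
  import Data.Rational.Properties as ℚ
  open import Data.Fin as Fin using (Fin)
  import Data.Fin.Properties as Fin
  open import Data.List using (List; cartesianProduct; allFin)
  open import Data.List.Membership.Propositional using (_∈_)
  open import Data.List.Membership.Propositional.Properties
    using (∈-cartesianProduct⁺; ∈-cartesianProduct⁻; ∈-allFin; ∈-map⁺; ∈-map⁻; ∈-upTo⁺; ∈-upTo⁻)
  open import Data.List.Relation.Unary.All as All using (All)
  open import Data.List.Relation.Unary.Unique.Propositional using (Unique)
  import Data.List.Relation.Unary.Unique.Propositional.Properties as Unique
  open import Data.Product using (_×_; _,_; Σ; proj₁; proj₂)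
  open import Function using (_∘_; _⇔_; mk⇔; Equivalence)
  import Function.Properties.Equivalence as ⇔
  open import Relation.Nullary using (yes; no; contradiction)
  open import Relation.Unary using (Decidable)
  open import Relation.Binary.Definitions using (tri<; tri≈; tri>)
  open import Relation.Binary.PropositionalEquality using (_≡_; _≢_; _≗_; refl; sym; cong; subst₂)

  private
    variable
      n : ℕ

  Decreasing : Point n → Set
  Decreasing y = ∀ a b → a Fin.< b → y b < y a

  Below : Point n → Fin n → ℕ → Fin n → ℕ → Set
  Below x a k b k′ = x a + ι k < x b + ι k′

  below-diagonal : ∀ {x y : Point n} {a b} k k′ → Below x a k a k′ → Below y b k b k′
  below-diagonal {x = x} {y} {a} {b} k k′ =
    Equivalence.from (p+ιk<p+ιk′⇔k<k′ (y b) k k′) ∘ Equivalence.to (p+ιk<p+ιk′⇔k<k′ (x a) k k′)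

  below-0⇔< : ∀ (x : Point n) a b → Below x a 0 b 0 ⇔ x a < x b
  below-0⇔< x a b = ⇔.sym (<-translate 0ℚ refl refl)

  markers : (r n : ℕ) → List (Fin n × ℕ)
  markers r n = cartesianProduct (allFin n) (range1 r)

  ∈markers⁺ : ∀ {r} (i : Fin n) {k} → 1 ℕ.≤ k → k ℕ.≤ r → (i , k) ∈ markers r n
  ∈markers⁺ i {suc k} _ k<r = ∈-cartesianProduct⁺ (∈-allFin i) (∈-map⁺ suc (∈-upTo⁺ k<r))

  ∈markers⁻ : ∀ {r} {i : Fin n} {k} → (i , k) ∈ markers r n → 1 ℕ.≤ k × k ℕ.≤ r
  ∈markers⁻ {n} {r} m with _ , k∈ ← ∈-cartesianProduct⁻ (allFin n) (range1 r) m
                      with _ , j∈ , refl ← ∈-map⁻ suc k∈ = s≤s z≤n , ∈-upTo⁻ j∈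

  markers-unique : ∀ r n → Unique (markers r n)
  markers-unique r n = Unique.cartesianProduct⁺ (Unique.allFin⁺ n) (Unique.map⁺ ℕ.suc-injective (Unique.upTo⁺ r))

  Counted : Point n → Fin n → Fin n × ℕ → Set
  Counted x j p = 0ℚ < d x (proj₁ p) j (proj₂ p)

  counted? : (x : Point n) (j : Fin n) → Decidable (Counted x j)
  counted? x j p = 0ℚ ℚ.<? d x (proj₁ p) j (proj₂ p)

  counted⇔below : ∀ (x : Point n) i j k → Counted x j (i , k) ⇔ Below x j k i 0
  counted⇔below x i j k with i Fin.≟ j
  ... | no _     = 0<p-q-s⇔q+s<p+0 (x i) (x j) (ι k)
  ... | yes refl = mk⇔ (λ 0<0 → contradiction 0<0 (ℚ.<-irrefl refl))
                       (λ below → contradiction (Equivalence.to (p+ιk<p+ιk′⇔k<k′ (x j) k 0) below) λ ())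

  diff<⇔below : ∀ (x : Point n) a b k k′ → x a - x b < ℤ→ℚ (k′ ⊖ k) ⇔ Below x a k b k′
  diff<⇔below x a b k k′ rewrite ℤ→ℚ-⊖ k′ k = p-q<s-t⇔p+t<q+s (x a) (x b) (ι k′) (ι k)

  diff≡⇔shifts≡ : ∀ (x : Point n) a b k k′ → x a - x b ≡ ℤ→ℚ (k′ ⊖ k) ⇔ x a + ι k ≡ x b + ι k′
  diff≡⇔shifts≡ x a b k k′ rewrite ℤ→ℚ-⊖ k′ k = p-q≡s-t⇔p+t≡q+s (x a) (x b) (ι k′) (ι k)

  ∣⊖∣≤ : ∀ {r k k′} → k ℕ.≤ r → k′ ℕ.≤ r → ℤ.∣ k′ ⊖ k ∣ ℕ.≤ r
  ∣⊖∣≤ {k = k} {k′} k≤r k′≤r = ℕ.≤-trans (ℤ.∣m⊝n∣≤m⊔n k′ k) (ℕ.⊔-lub k′≤r k≤r)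

  bounded⇒⊖ : ∀ {r} c → ℤ.∣ c ∣ ℕ.≤ r →
              Σ ℕ λ k → Σ ℕ λ k′ → k ℕ.≤ r × k′ ℕ.≤ r × c ≡ k′ ⊖ k
  bounded⇒⊖ (+ m)      m≤r  = 0 , m , z≤n , m≤r , refl
  bounded⇒⊖ -[1+ m ]   m<r  = suc m , 0 , m<r , z≤n , refl

  sameRegion-sym : ∀ {r} {x y : Point n} → SameRegion r n x y → SameRegion r n y x
  sameRegion-sym same i j i<j c ∣c∣≤r = ⇔.sym (same i j i<j c ∣c∣≤r)

  module _ (r : ℕ) where

    ShiftsDistinct : Point n → Set
    ShiftsDistinct x = ∀ a b → a ≢ b → ∀ k k′ → k ℕ.≤ r → k′ ℕ.≤ r → x a + ι k ≢ x b + ι k′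

    PreservesBelow : Point n → Point n → Set
    PreservesBelow x y = ∀ a b k k′ → k ℕ.≤ r → k′ ℕ.≤ r → Below x a k b k′ → Below y a k b k′

    inComplement⇒shiftsDistinct : ∀ {x : Point n} → InComplement r n x → ShiftsDistinct x
    inComplement⇒shiftsDistinct {x = x} inC a b a≢b k k′ k≤r k′≤r eq with Fin.<-cmp a b
    ... | tri< a<b _ _ = inC a b a<b (k′ ⊖ k) (∣⊖∣≤ k≤r k′≤r) (Equivalence.from (diff≡⇔shifts≡ x a b k k′) eq)
    ... | tri≈ _ a≡b _ = a≢b a≡b
    ... | tri> _ _ b<a = inC b a b<a (k ⊖ k′) (∣⊖∣≤ k′≤r k≤r) (Equivalence.from (diff≡⇔shifts≡ x b a k′ k) (sym eq))

    shiftsDistinct⇒inComplement : ∀ {x : Point n} → ShiftsDistinct x → InComplement r n x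
    shiftsDistinct⇒inComplement {x = x} distinct i j i<j c ∣c∣≤r with bounded⇒⊖ c ∣c∣≤r
    ... | k , k′ , k≤r , k′≤r , refl =
      distinct i j (Fin.<⇒≢ i<j) k k′ k≤r k′≤r ∘ Equivalence.to (diff≡⇔shifts≡ x i j k k′)

    shiftsDistinct⇒injective : ∀ {x : Point n} → ShiftsDistinct x → ∀ {i j} → x i ≡ x j → i ≡ j
    shiftsDistinct⇒injective {x = x} distinct {i} {j} eq with i Fin.≟ j
    ... | yes i≡j = i≡j
    ... | no  i≢j = contradiction (cong (_+ ι 0) eq) (distinct i j i≢j 0 0 z≤n z≤n)

    shiftsDistinct-∘ : ∀ {m} {x : Point n} {f : Fin m → Fin n} → (∀ {a b} → f a ≡ f b → a ≡ b) →
                       ShiftsDistinct x → ShiftsDistinct (x ∘ f)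
    shiftsDistinct-∘ f-injective distinct a b a≢b = distinct _ _ (a≢b ∘ f-injective)

    preservesBelow-∘ : ∀ {m} {x y : Point n} (f : Fin m → Fin n) → PreservesBelow x y → PreservesBelow (x ∘ f) (y ∘ f)
    preservesBelow-∘ f x⇒y a b = x⇒y (f a) (f b)

    preservesBelow-resp : ∀ {x x′ y y′ : Point n} → x ≗ x′ → y ≗ y′ →
                          PreservesBelow x y → PreservesBelow x′ y′
    preservesBelow-resp {x = x} {x′} {y} {y′} x≗x′ y≗y′ x⇒y a b k k′ k≤r k′≤r =
      subst₂ (λ p q → p + ι k < q + ι k′) (y≗y′ a) (y≗y′ b) ∘ x⇒y a b k k′ k≤r k′≤r
      ∘ subst₂ (λ p q → p + ι k < q + ι k′) (sym (x≗x′ a)) (sym (x≗x′ b))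

    preservesBelow-≗ : ∀ {x y : Point n} → x ≗ y → PreservesBelow x y
    preservesBelow-≗ {x = x} {y} x≗y = preservesBelow-resp {x = x} {x} {x} {y} (λ _ → refl) x≗y (λ _ _ _ _ _ _ below → below)

    preservesBelow-from-ordered-pairs : ∀ {x y : Point n} → ShiftsDistinct y →
      (∀ a b → a Fin.< b → ∀ k k′ → k ℕ.≤ r → k′ ℕ.≤ r → Below x a k b k′ → Below y a k b k′) →
      (∀ a b → a Fin.< b → ∀ k k′ → k ℕ.≤ r → k′ ℕ.≤ r → Below y a k b k′ → Below x a k b k′) →
      PreservesBelow x y
    preservesBelow-from-ordered-pairs {x = x} {y} distinct x⇒y y⇒x a b k k′ k≤r k′≤r below with Fin.<-cmp a b
    ... | tri< a<b _ _ = x⇒y a b a<b k k′ k≤r k′≤r below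
    ... | tri≈ _ refl _ = below-diagonal {x = x} {y} k k′ below
    ... | tri> _ a≢b b<a = ≢∧≯⇒< (distinct a b a≢b k k′ k≤r k′≤r)
                                   (λ below′ → ℚ.<-asym below (y⇒x b a b<a k′ k k′≤r k≤r below′))

    sameRegion⇒preservesBelow : ∀ {x y : Point n} → InComplement r n y → SameRegion r n x y → PreservesBelow x y
    sameRegion⇒preservesBelow {x = x} {y} inC-y same =
      preservesBelow-from-ordered-pairs {x = x} {y} (inComplement⇒shiftsDistinct {x = y} inC-y)
        (λ a b a<b k k′ k≤r k′≤r → Equivalence.to (diff<⇔below y a b k k′)
           ∘ Equivalence.to (same a b a<b (k′ ⊖ k) (∣⊖∣≤ k≤r k′≤r)) ∘ Equivalence.from (diff<⇔below x a b k k′))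
        (λ a b a<b k k′ k≤r k′≤r → Equivalence.to (diff<⇔below x a b k k′)
           ∘ Equivalence.from (same a b a<b (k′ ⊖ k) (∣⊖∣≤ k≤r k′≤r)) ∘ Equivalence.from (diff<⇔below y a b k k′))

    preservesBelow⇒sameRegion : ∀ {x y : Point n} → PreservesBelow x y → PreservesBelow y x → SameRegion r n x y
    preservesBelow⇒sameRegion {x = x} {y} x⇒y y⇒x i j i<j c ∣c∣≤r with bounded⇒⊖ c ∣c∣≤r
    ... | k , k′ , k≤r , k′≤r , refl = mk⇔
      (Equivalence.from (diff<⇔below y i j k k′) ∘ x⇒y i j k k′ k≤r k′≤r ∘ Equivalence.to (diff<⇔below x i j k k′))
      (Equivalence.from (diff<⇔below x i j k k′) ∘ y⇒x i j k k′ k≤r k′≤r ∘ Equivalence.to (diff<⇔below y i j k k′))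

    preservesBelow⇒counted : ∀ {x y : Point n} → PreservesBelow x y →
                             ∀ j {p} → p ∈ markers r n → Counted x j p → Counted y j p
    preservesBelow⇒counted {x = x} {y} x⇒y j {i , k} p∈ = Equivalence.from (counted⇔below y i j k)
      ∘ x⇒y j i k 0 (proj₂ (∈markers⁻ p∈)) z≤n ∘ Equivalence.to (counted⇔below x i j k)

    h-cong : ∀ {x y : Point n} → PreservesBelow x y → PreservesBelow y x → ∀ j → h r x j ≡ h r y j
    h-cong {x = x} {y} x⇒y y⇒x j = count-cong (counted? x j) (counted? y j)
      (All.tabulate (preservesBelow⇒counted x⇒y j)) (All.tabulate (preservesBelow⇒counted y⇒x j))

    decreasing-cong : ∀ {x y : Point n} → PreservesBelow x y → Decreasing x → Decreasing y
    decreasing-cong {x = x} {y} x⇒y x↓ a b a<b =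
      Equivalence.to (below-0⇔< y b a) (x⇒y b a 0 0 z≤n z≤n (Equivalence.from (below-0⇔< x b a) (x↓ a b a<b)))

module Sorting where

  open Counting
  open import Data.Nat as ℕ using (ℕ; suc; z≤n; s≤s)
  import Data.Nat.Properties as ℕ
  open import Data.Rational using (_<_)
  import Data.Rational.Properties as ℚ
  open import Data.Fin as Fin using (Fin; toℕ)
  import Data.Fin.Properties as Fin
  open import Data.Fin.Induction using (<-weakInduction)
  open import Data.Fin.Permutation using (Permutation′; _⟨$⟩ʳ_; _⟨$⟩ˡ_; inverseˡ; inverseʳ; permutation)
  open import Data.List using (allFin)
  open import Data.List.Properties using (length-tabulate)
  open import Data.List.Membership.Propositional.Properties using (∈-allFin)
  open import Data.List.Relation.Unary.All as All using (All)
  open import Data.Product using (_,_; ∃-syntax; proj₁; proj₂)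
  open import Data.Unit using (⊤; tt)
  open import Function using (_∘_)
  open import Relation.Nullary using (yes; no; contradiction)
  open import Relation.Unary using (Decidable)
  open import Relation.Binary.Definitions using (tri<; tri≈; tri>)
  open import Relation.Binary.PropositionalEquality
    using (_≡_; refl; sym; trans; cong; subst; subst₂; module ≡-Reasoning)

  private
    variable
      n : ℕ

  sorts-reflect : ∀ {σ : Permutation′ n} {x : Point n} {a b} → Sorts σ x → x (σ ⟨$⟩ʳ b) < x (σ ⟨$⟩ʳ a) → a Fin.< b
  sorts-reflect {a = a} {b} sorted lt with Fin.<-cmp a b
  ... | tri< a<b _ _ = a<b
  ... | tri≈ _ refl _ = contradiction lt (ℚ.<-irrefl refl)
  ... | tri> _ _ b<a = contradiction (sorted b a b<a) (ℚ.<-asym lt)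

  sorting-transition-increasing : ∀ {σ τ : Permutation′ n} {x : Point n} → Sorts σ x → Sorts τ x →
                                  ∀ {a b} → a Fin.< b → σ ⟨$⟩ˡ (τ ⟨$⟩ʳ a) Fin.< σ ⟨$⟩ˡ (τ ⟨$⟩ʳ b)
  sorting-transition-increasing {σ = σ} {τ} {x} σ-sorts τ-sorts {a} {b} a<b =
    sorts-reflect {σ = σ} {x} σ-sorts (subst₂ _<_ (cong x (sym (inverseʳ σ))) (cong x (sym (inverseʳ σ))) (τ-sorts a b a<b))

  strictlyIncreasing⇒inflationary : (f : Fin n → Fin n) → (∀ {a b} → a Fin.< b → f a Fin.< f b) → ∀ a → a Fin.≤ f a
  strictlyIncreasing⇒inflationary {suc n} f f-increasing = <-weakInduction (λ a → a Fin.≤ f a) z≤n step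
    where
    step : ∀ i → Fin.inject₁ i Fin.≤ f (Fin.inject₁ i) → Fin.suc i Fin.≤ f (Fin.suc i)
    step i ih = ℕ.≤-<-trans (subst (ℕ._≤ toℕ (f (Fin.inject₁ i))) (Fin.toℕ-inject₁ i) ih)
                            (f-increasing {Fin.inject₁ i} {Fin.suc i} (s≤s (ℕ.≤-reflexive (Fin.toℕ-inject₁ i))))

  sorting-unique : ∀ {σ τ : Permutation′ n} {x : Point n} → Sorts σ x → Sorts τ x → ∀ i → σ ⟨$⟩ʳ i ≡ τ ⟨$⟩ʳ i
  sorting-unique {σ = σ} {τ} {x} σ-sorts τ-sorts i = begin
    σ ⟨$⟩ʳ i                    ≡⟨ cong (σ ⟨$⟩ʳ_) (sym (Fin.toℕ-injective (ℕ.≤-antisym fi≤i i≤fi))) ⟩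
    σ ⟨$⟩ʳ (σ ⟨$⟩ˡ (τ ⟨$⟩ʳ i))  ≡⟨ inverseʳ σ ⟩
    τ ⟨$⟩ʳ i                    ∎
    where
    open ≡-Reasoning
    f g : Fin _ → Fin _
    f a = σ ⟨$⟩ˡ (τ ⟨$⟩ʳ a)
    g a = τ ⟨$⟩ˡ (σ ⟨$⟩ʳ a)
    i≤fi : i Fin.≤ f i
    i≤fi = strictlyIncreasing⇒inflationary f (sorting-transition-increasing {σ = σ} {τ} {x} σ-sorts τ-sorts) i
    fi≤i : f i Fin.≤ i
    fi≤i = subst (λ a → f i Fin.≤ a) (trans (cong (τ ⟨$⟩ˡ_) (inverseʳ σ)) (inverseˡ τ))
             (strictlyIncreasing⇒inflationary g (sorting-transition-increasing {σ = τ} {σ} {x} τ-sorts σ-sorts) (f i))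

  injective⇒surjective : (f : Fin n → Fin n) → (∀ {a b} → f a ≡ f b → a ≡ b) → ∀ c → ∃[ a ] f a ≡ c
  injective⇒surjective {suc m} f f-injective c with Fin.any? (λ a → f a Fin.≟ c)
  ... | yes found = found
  ... | no missed = contradiction (Fin.injective⇒≤ punched-injective) ℕ.1+n≰n
    where
    punched : Fin (suc m) → Fin m
    punched a = Fin.punchOut {i = c} {j = f a} (λ c≡fa → missed (a , sym c≡fa))
    punched-injective : ∀ {a b} → punched a ≡ punched b → a ≡ b
    punched-injective {a} {b} = f-injective ∘ Fin.punchOut-injective {i = c} {j = f a} {k = f b} _ _

  module _ (x : Point n) (x-injective : ∀ {i j} → x i ≡ x j → i ≡ j) where

    private
      rank : Fin n → ℕ
      rank b = count (λ c → x b ℚ.<? x c) (allFin n)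

      rank<n : ∀ b → rank b ℕ.< n
      rank<n b = subst (rank b ℕ.<_) (trans (count-all all? (All.universal _ (allFin n))) (length-tabulate (λ i → i)))
        (count-< (λ c → x b ℚ.<? x c) all? (All.universal (λ _ _ → tt) (allFin n)) (∈-allFin b) tt (ℚ.<-irrefl refl))
        where
        all? : Decidable {A = Fin n} (λ _ → ⊤)
        all? _ = yes tt

      rank-antitone : ∀ {b b′} → x b < x b′ → rank b′ ℕ.< rank b
      rank-antitone {b} {b′} xb<xb′ = count-< (λ c → x b′ ℚ.<? x c) (λ c → x b ℚ.<? x c)
        (All.universal (λ _ → ℚ.<-trans xb<xb′) _) (∈-allFin b′) xb<xb′ (ℚ.<-irrefl refl)

      rankFin : Fin n → Fin n
      rankFin b = Fin.fromℕ< (rank<n b)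

      toℕ-rankFin : ∀ b → toℕ (rankFin b) ≡ rank b
      toℕ-rankFin b = Fin.toℕ-fromℕ< (rank<n b)

      rank-injective : ∀ {b b′} → rank b ≡ rank b′ → b ≡ b′
      rank-injective {b} {b′} same-rank with ℚ.<-cmp (x b) (x b′)
      ... | tri< lt _ _ = contradiction (rank-antitone lt) (ℕ.<-irrefl (sym same-rank))
      ... | tri≈ _ x≡ _ = x-injective x≡
      ... | tri> _ _ gt = contradiction (rank-antitone gt) (ℕ.<-irrefl same-rank)

      rankFin-injective : ∀ {b b′} → rankFin b ≡ rankFin b′ → b ≡ b′
      rankFin-injective {b} {b′} eq = rank-injective (trans (sym (toℕ-rankFin b)) (trans (cong toℕ eq) (toℕ-rankFin b′)))

      unrank : Fin n → Fin n
      unrank a = proj₁ (injective⇒surjective rankFin rankFin-injective a)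

      rankFin-unrank : ∀ a → rankFin (unrank a) ≡ a
      rankFin-unrank a = proj₂ (injective⇒surjective rankFin rankFin-injective a)

      rank-unrank : ∀ a → rank (unrank a) ≡ toℕ a
      rank-unrank a = trans (sym (toℕ-rankFin (unrank a))) (cong toℕ (rankFin-unrank a))

    sortingPermutation : Permutation′ n
    sortingPermutation = permutation unrank rankFin (λ b → rankFin-injective (rankFin-unrank (rankFin b))) rankFin-unrank

    sortingPermutation-sorts : Sorts sortingPermutation x
    sortingPermutation-sorts a b a<b with ℚ.<-cmp (x (unrank a)) (x (unrank b))
    ... | tri> _ _ gt = gt
    ... | tri≈ _ x≡ _ = contradiction (trans (sym (rankFin-unrank a)) (trans (cong rankFin (x-injective x≡)) (rankFin-unrank b)))
                                      (Fin.<⇒≢ a<b)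
    ... | tri< lt _ _ = contradiction a<b (ℕ.<⇒≯ (subst₂ ℕ._<_ (rank-unrank b) (rank-unrank a) (rank-antitone lt)))

module SortedPoints where

  open Arithmetic
  open Counting
  open Regions
  open import Data.Nat as ℕ using (ℕ; zero; suc; z≤n; s≤s⁻¹)
  import Data.Nat.Properties as ℕ
  open import Data.Rational using (_+_; _<_; _≤_)
  import Data.Rational.Properties as ℚ
  open import Data.Fin as Fin using (Fin; toℕ)
  import Data.Fin.Properties as Fin
  open import Data.List using (length; upTo; allFin)
  open import Data.List.Properties using (length-map; length-upTo)
  open import Data.List.Relation.Unary.All as All using (All)
  open import Data.Product using (_×_; _,_; proj₁; proj₂)
  open import Data.Sum using (_⊎_; inj₁; inj₂)
  open import Function using (_∘_; Equivalence)
  open import Relation.Nullary using (¬_; yes; no; contradiction)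
  open import Relation.Binary.Definitions using (tri<; tri≈; tri>)
  open import Relation.Binary.PropositionalEquality using (_≡_; refl; sym; trans; cong; cong₂; subst; module ≡-Reasoning)

  private
    variable
      n : ℕ

  count-markers-below : ∀ r {n} b → b ℕ.≤ n → count ((λ i → toℕ i ℕ.<? b) ∘ proj₁) (markers r n) ≡ r ℕ.* b
  count-markers-below r {n} b b≤n = begin
    count ((λ i → toℕ i ℕ.<? b) ∘ proj₁) (markers r n)
      ≡⟨ count-cartesianProduct (λ i → toℕ i ℕ.<? b) (allFin n) (range1 r) ⟩
    count (λ i → toℕ i ℕ.<? b) (allFin n) ℕ.* length (range1 r)
      ≡⟨ cong₂ ℕ._*_ (count-toℕ< b b≤n) (trans (length-map suc (upTo r)) (length-upTo r)) ⟩
    b ℕ.* r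
      ≡⟨ ℕ.*-comm b r ⟩
    r ℕ.* b ∎
    where open ≡-Reasoning

  module _ {n} {y : Point n} (y↓ : Decreasing y) where

    decreasing-≤ : ∀ {j j′} → toℕ j ℕ.≤ toℕ j′ → y j′ ≤ y j
    decreasing-≤ {j} {j′} j≤j′ with ℕ.m≤n⇒m<n∨m≡n j≤j′
    ... | inj₁ j<j′ = ℚ.<⇒≤ (y↓ j j′ j<j′)
    ... | inj₂ j≡j′ = ℚ.≤-reflexive (cong y (sym (Fin.toℕ-injective j≡j′)))

    below⇒index< : ∀ {i j k} → Below y j k i 0 → toℕ i ℕ.< toℕ j
    below⇒index< {i} {j} {k} below with ℕ.<-cmp (toℕ i) (toℕ j)
    ... | tri< i<j _ _ = i<j
    ... | tri≈ _ i≡j _ = contradiction (Equivalence.to (p+ιk<p+ιk′⇔k<k′ (y j) k 0) below′) λ ()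
      where below′ = subst (λ i → Below y j k i 0) (Fin.toℕ-injective i≡j) below
    ... | tri> _ _ j<i = contradiction below (ℚ.<-asym (ℚ.+-mono-<-≤ (y↓ j i j<i) (ι-mono-≤ {0} {k} z≤n)))

    h-bounded : ∀ r j → h r y j ℕ.≤ r ℕ.* toℕ j
    h-bounded r j = ℕ.≤-trans
      (count-mono (counted? y j) ((λ i → toℕ i ℕ.<? toℕ j) ∘ proj₁)
         (All.universal (λ (i , k) → below⇒index< {i} {j} {k} ∘ Equivalence.to (counted⇔below y i j k)) (markers r n)))
      (ℕ.≤-reflexive (count-markers-below r (toℕ j) (ℕ.<⇒≤ (Fin.toℕ<n j))))

    h-monotone : ∀ r {j j′} → toℕ j ℕ.≤ toℕ j′ → h r y j ℕ.≤ h r y j′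
    h-monotone r {j} {j′} j≤j′ = count-mono (counted? y j) (counted? y j′) (All.universal shift (markers r n))
      where
      shift : ∀ p → Counted y j p → Counted y j′ p
      shift (i , k) = Equivalence.from (counted⇔below y i j′ k)
                    ∘ ℚ.≤-<-trans (ℚ.+-monoˡ-≤ (ι k) (decreasing-≤ j≤j′)) ∘ Equivalence.to (counted⇔below y i j k)

  below-combine : ∀ (x : Point n) c i e K K′ → ¬ Below x c K′ i 0 → Below x c K e 0 → Below x i K e K′
  below-combine x c i e K K′ not-below below =
    shift-trans {a = x i} {x c} {x e} {ι K} {ι K′} {ι 0} (ℚ.≮⇒≥ not-below) below

  module _ (r : ℕ) {n : ℕ} where

    PreservesBelowUpTo : ℕ → Point n → Point n → Set
    PreservesBelowUpTo m y z = ∀ a b → toℕ a ℕ.< m → toℕ b ℕ.< m →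
                               ∀ k k′ → k ℕ.≤ r → k′ ℕ.≤ r → Below y a k b k′ → Below z a k b k′

    module _ {y z : Point n} (y↓ : Decreasing y) (z↓ : Decreasing z) (same-h : ∀ j → h r y j ≡ h r z j)
             (c : Fin n) (agree : PreservesBelowUpTo (toℕ c) y z) where

      shifted-new-below-old : ∀ e K → toℕ e ℕ.< toℕ c → 1 ℕ.≤ K → K ℕ.≤ r → Below y c K e 0 → Below z c K e 0
      shifted-new-below-old e K e<c 1≤K K≤r y-below with (z c + ι K) ℚ.<? (z e + ι 0)
      ... | yes z-below = z-below
      ... | no z-not-below
        -- (e , K) is counted at c for y but not for z, so equal counts yield an (i , K′) counted for z
        -- but not for y; the two pictures give opposite inequalities between the old points i and e.
        with (i , K′) , i∈ , counted-z , not-counted-y ←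
               count-exchange (counted? y c) (counted? z c) (same-h c) (∈markers⁺ e 1≤K K≤r)
                 (Equivalence.from (counted⇔below y e c K) y-below) (z-not-below ∘ Equivalence.to (counted⇔below z e c K))
        = contradiction (agree i e (below⇒index< z↓ {i} {c} {K′} z-below′) e<c K K′ K≤r (proj₂ (∈markers⁻ i∈)) y-combined)
                        (ℚ.<-asym z-combined)
        where
        z-below′ : Below z c K′ i 0
        z-below′ = Equivalence.to (counted⇔below z i c K′) counted-z
        y-combined : Below y i K e K′
        y-combined = below-combine y c i e K K′ (not-counted-y ∘ Equivalence.from (counted⇔below y i c K′)) y-below
        z-combined : Below z e K′ i K
        z-combined = below-combine z c e i K′ K z-not-below z-below′

      new-below-old : ∀ e k k′ → toℕ e ℕ.< toℕ c → k ℕ.≤ r → k′ ℕ.≤ r → Below y c k e k′ → Below z c k e k′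
      new-below-old e k k′ e<c k≤r k′≤r y-below with k ℕ.≤? k′
      ... | yes k≤k′ = ℚ.+-mono-<-≤ (z↓ e c e<c) (ι-mono-≤ k≤k′)
      ... | no k≰k′ = subst (λ k → Below z c k e k′) k≡K+k′
          (Equivalence.from (shift-cancel (z c) (z e) K 0 k′)
            (shifted-new-below-old e K e<c (ℕ.m<n⇒0<n∸m k′<k) (ℕ.≤-trans (ℕ.m∸n≤m k k′) k≤r)
              (Equivalence.to (shift-cancel (y c) (y e) K 0 k′) (subst (λ k → Below y c k e k′) (sym k≡K+k′) y-below))))
        where
        K : ℕ
        K = k ℕ.∸ k′
        k′<k : k′ ℕ.< k
        k′<k = ℕ.≰⇒> k≰k′
        k≡K+k′ : K ℕ.+ k′ ≡ k
        k≡K+k′ = ℕ.m∸n+n≡m (ℕ.<⇒≤ k′<k)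

    private
      index-split : ∀ {m} (a : Fin n) → toℕ a ℕ.< suc m → toℕ a ℕ.< m ⊎ toℕ a ≡ m
      index-split a a<1+m = ℕ.m≤n⇒m<n∨m≡n (s≤s⁻¹ a<1+m)

    preservesBelowUpTo-suc : ∀ {m} {y z : Point n} → Decreasing y → Decreasing z → ShiftsDistinct r z →
                             (∀ j → h r y j ≡ h r z j) →
                             PreservesBelowUpTo m y z → PreservesBelowUpTo m z y → PreservesBelowUpTo (suc m) y z
    preservesBelowUpTo-suc {m} {y} {z} y↓ z↓ z-distinct same-h y⇒z z⇒y a b a<1+m b<1+m k k′ k≤r k′≤r below
      with index-split a a<1+m | index-split b b<1+m
    ... | inj₁ a<m | inj₁ b<m = y⇒z a b a<m b<m k k′ k≤r k′≤r below
    ... | inj₂ refl | inj₁ b<m = new-below-old y↓ z↓ same-h a y⇒z b k k′ b<m k≤r k′≤r below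
    ... | inj₁ a<m | inj₂ refl = ≢∧≯⇒< (z-distinct a b (Fin.<⇒≢ a<m) k k′ k≤r k′≤r)
      (λ z-below → ℚ.<-asym below (new-below-old z↓ y↓ (sym ∘ same-h) b z⇒y a k′ k a<m k′≤r k≤r z-below))
    ... | inj₂ a≡m | inj₂ b≡m with Fin.toℕ-injective {i = a} {b} (trans a≡m (sym b≡m))
    ...   | refl = below-diagonal {x = y} {z} k k′ below

    preservesBelow-from-heights : ∀ {y z : Point n} → Decreasing y → Decreasing z → ShiftsDistinct r y → ShiftsDistinct r z →
                                  (∀ j → h r y j ≡ h r z j) → PreservesBelow r y z
    preservesBelow-from-heights {y} {z} y↓ z↓ y-distinct z-distinct same-h a b =
      proj₁ (agreement n) a b (Fin.toℕ<n a) (Fin.toℕ<n b)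
      where
      agreement : ∀ m → PreservesBelowUpTo m y z × PreservesBelowUpTo m z y
      agreement zero    = (λ _ _ ()) , (λ _ _ ())
      agreement (suc m) = preservesBelowUpTo-suc {m} {y} {z} y↓ z↓ z-distinct same-h (proj₁ (agreement m)) (proj₂ (agreement m))
                   , preservesBelowUpTo-suc {m} {z} {y} z↓ y↓ y-distinct (sym ∘ same-h) (proj₂ (agreement m)) (proj₁ (agreement m))

module DyckPaths where

  open import Data.Nat using (ℕ; zero; suc; _+_; _*_; _∸_; _≤_; _<_; z≤n; s≤s; s≤s⁻¹)
  open import Data.Nat.Properties
    using (≤-refl; ≤-trans; ≤-reflexive; n≤1+n; m≤m+n; +-identityʳ; +-suc; +-assoc; m+[n∸m]≡n;
           *-monoʳ-≤; <-irrefl; suc-injective)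
  open import Data.Fin using (Fin; toℕ)
  import Data.Fin as Fin
  open import Data.List using (List; []; _∷_; length; take; _++_; replicate; tabulate)
  open import Data.List.Relation.Unary.All as All using (All; []; _∷_)
  open import Data.List.Properties using (∷-injectiveˡ; ∷-injectiveʳ; ++-identityʳ)
  open import Data.Product using (_×_; _,_; Σ)
  open import Relation.Nullary using (contradiction)
  open import Relation.Binary.PropositionalEquality
    using (_≡_; refl; sym; trans; cong; subst; subst₂; module ≡-Reasoning)

  heightsFrom-≥ : ∀ c P → All (c ≤_) (heightsFrom c P)
  heightsFrom-≥ c [] = []
  heightsFrom-≥ c (E ∷ P) = ≤-refl ∷ heightsFrom-≥ c P
  heightsFrom-≥ c (N ∷ P) = All.map (≤-trans (n≤1+n c)) (heightsFrom-≥ (suc c) P)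

  length-heightsFrom : ∀ c P → length (heightsFrom c P) ≡ countE P
  length-heightsFrom c []      = refl
  length-heightsFrom c (E ∷ P) = cong suc (length-heightsFrom c P)
  length-heightsFrom c (N ∷ P) = length-heightsFrom (suc c) P

  heightsFrom-injective : ∀ c P Q → countN P ≡ countN Q → heightsFrom c P ≡ heightsFrom c Q → P ≡ Q
  heightsFrom-injective c [] [] _ _ = refl
  heightsFrom-injective c [] (N ∷ Q) () _
  heightsFrom-injective c (N ∷ P) [] () _
  heightsFrom-injective c (E ∷ P) (E ∷ Q) #N heights≡ =
    cong (E ∷_) (heightsFrom-injective c P Q #N (∷-injectiveʳ heights≡))
  heightsFrom-injective c (N ∷ P) (N ∷ Q) #N heights≡ =
    cong (N ∷_) (heightsFrom-injective (suc c) P Q (suc-injective #N) heights≡)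
  heightsFrom-injective c (E ∷ P) (N ∷ Q) _ heights≡ =
    contradiction (All.head (subst (All (suc c ≤_)) (sym heights≡) (heightsFrom-≥ (suc c) Q))) (<-irrefl refl)
  heightsFrom-injective c (N ∷ P) (E ∷ Q) _ heights≡ =
    contradiction (All.head (subst (All (suc c ≤_)) heights≡ (heightsFrom-≥ (suc c) P))) (<-irrefl refl)

  dyckPath-heights-injective : ∀ {r n} P Q → IsDyck r n P → IsDyck r n Q → heights P ≡ heights Q → P ≡ Q
  dyckPath-heights-injective P Q (_ , #N-P , _) (_ , #N-Q , _) = heightsFrom-injective 0 P Q (trans #N-P (sym #N-Q))

  module _ (r : ℕ) where

    NeverAbove : ℕ → ℕ → Path → Set
    NeverAbove e c P = ∀ m → c + countN (take m P) ≤ r * (e + countE (take m P))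

    private
      at-start : ∀ {e c} → c ≤ r * e → c + 0 ≤ r * (e + 0)
      at-start {e} {c} = subst₂ _≤_ (sym (+-identityʳ c)) (cong (r *_) (sym (+-identityʳ e)))

    neverAbove-start : ∀ {e c P} → NeverAbove e c P → c ≤ r * e
    neverAbove-start {e} {c} ok = subst₂ _≤_ (+-identityʳ c) (cong (r *_) (+-identityʳ e)) (ok 0)

    neverAbove-[] : ∀ {e c} → c ≤ r * e → NeverAbove e c []
    neverAbove-[] c≤re zero    = at-start c≤re
    neverAbove-[] c≤re (suc m) = at-start c≤re

    neverAbove-N : ∀ {e c P} → c ≤ r * e → NeverAbove e (suc c) P → NeverAbove e c (N ∷ P)
    neverAbove-N c≤re ok zero = at-start c≤re
    neverAbove-N {e} {c} {P} c≤re ok (suc m) =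
      subst (_≤ r * (e + countE (take m P))) (sym (+-suc c _)) (ok m)

    neverAbove-E : ∀ {e c P} → c ≤ r * e → NeverAbove (suc e) c P → NeverAbove e c (E ∷ P)
    neverAbove-E c≤re ok zero = at-start c≤re
    neverAbove-E {e} {c} {P} c≤re ok (suc m) =
      subst (λ w → c + countN (take m P) ≤ r * w) (sym (+-suc e _)) (ok m)

    neverAbove-N⁻ : ∀ {e c P} → NeverAbove e c (N ∷ P) → NeverAbove e (suc c) P
    neverAbove-N⁻ {e} {c} {P} ok m = subst (_≤ r * (e + countE (take m P))) (+-suc c _) (ok (suc m))

    neverAbove-E⁻ : ∀ {e c P} → NeverAbove e c (E ∷ P) → NeverAbove (suc e) c P
    neverAbove-E⁻ {e} {c} {P} ok m = subst (λ w → c + countN (take m P) ≤ r * w) (+-suc e _) (ok (suc m))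

    data DyckHeights (e c : ℕ) : List ℕ → Set where
      []   : DyckHeights e c []
      cons : ∀ {y hs} → c ≤ y → y ≤ r * e → DyckHeights (suc e) y hs → DyckHeights e c (y ∷ hs)

    dyckHeights-weaken : ∀ {e c c′ hs} → c ≤ c′ → DyckHeights e c′ hs → DyckHeights e c hs
    dyckHeights-weaken c≤c′ []                  = []
    dyckHeights-weaken c≤c′ (cons c′≤y y≤re hs) = cons (≤-trans c≤c′ c′≤y) y≤re hs

    neverAbove⇒dyckHeights : ∀ {e c} P → NeverAbove e c P → DyckHeights e c (heightsFrom c P)
    neverAbove⇒dyckHeights []      ok = []
    neverAbove⇒dyckHeights (E ∷ P) ok =
      cons ≤-refl (neverAbove-start ok) (neverAbove⇒dyckHeights P (neverAbove-E⁻ ok))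
    neverAbove⇒dyckHeights (N ∷ P) ok =
      dyckHeights-weaken (n≤1+n _) (neverAbove⇒dyckHeights P (neverAbove-N⁻ ok))

    climb : ℕ → ℕ → List ℕ → Path
    climb e c []       = replicate (r * e ∸ c) N
    climb e c (y ∷ hs) = replicate (y ∸ c) N ++ E ∷ climb (suc e) y hs

    private
      countE-Ns : ∀ a P → countE (replicate a N ++ P) ≡ countE P
      countE-Ns zero    P = refl
      countE-Ns (suc a) P = countE-Ns a P

      countN-Ns : ∀ a P → countN (replicate a N ++ P) ≡ a + countN P
      countN-Ns zero    P = refl
      countN-Ns (suc a) P = cong suc (countN-Ns a P)

      heightsFrom-Ns : ∀ a c P → heightsFrom c (replicate a N ++ P) ≡ heightsFrom (c + a) P
      heightsFrom-Ns zero    c P = cong (λ c → heightsFrom c P) (sym (+-identityʳ c))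
      heightsFrom-Ns (suc a) c P = trans (heightsFrom-Ns a (suc c) P) (cong (λ c → heightsFrom c P) (sym (+-suc c a)))

      neverAbove-Ns : ∀ a {e c P} → c + a ≤ r * e → NeverAbove e (c + a) P → NeverAbove e c (replicate a N ++ P)
      neverAbove-Ns zero    {c = c} _ ok = subst (λ c → NeverAbove _ c _) (+-identityʳ c) ok
      neverAbove-Ns (suc a) {e} {c} {P} c+a≤re ok = neverAbove-N (≤-trans (m≤m+n c (suc a)) c+a≤re)
        (neverAbove-Ns a (subst (_≤ r * e) (+-suc c a) c+a≤re) (subst (λ c → NeverAbove e c P) (+-suc c a) ok))

    countE-climb : ∀ e c hs → countE (climb e c hs) ≡ length hs
    countE-climb e c []       = trans (cong countE (sym (++-identityʳ (replicate (r * e ∸ c) N)))) (countE-Ns (r * e ∸ c) [])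
    countE-climb e c (y ∷ hs) = trans (countE-Ns (y ∸ c) _) (cong suc (countE-climb (suc e) y hs))

    countN-climb : ∀ {e c hs} → c ≤ r * e → DyckHeights e c hs → c + countN (climb e c hs) ≡ r * (e + length hs)
    countN-climb {e} {c} c≤re [] = begin
      c + countN (replicate (r * e ∸ c) N)        ≡⟨ cong (λ P → c + countN P) (sym (++-identityʳ (replicate (r * e ∸ c) N))) ⟩
      c + countN (replicate (r * e ∸ c) N ++ [])  ≡⟨ cong (c +_) (trans (countN-Ns (r * e ∸ c) []) (+-identityʳ _)) ⟩
      c + (r * e ∸ c)                             ≡⟨ m+[n∸m]≡n c≤re ⟩
      r * e                                       ≡⟨ cong (r *_) (sym (+-identityʳ e)) ⟩
      r * (e + 0)                                 ∎
      where open ≡-Reasoning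
    countN-climb {e} {c} {y ∷ hs} _ (cons c≤y y≤re dh) = begin
      c + countN (replicate (y ∸ c) N ++ E ∷ climb (suc e) y hs) ≡⟨ cong (c +_) (countN-Ns (y ∸ c) _) ⟩
      c + ((y ∸ c) + countN (climb (suc e) y hs))                ≡⟨ sym (+-assoc c (y ∸ c) _) ⟩
      c + (y ∸ c) + countN (climb (suc e) y hs)                  ≡⟨ cong (_+ countN (climb (suc e) y hs)) (m+[n∸m]≡n c≤y) ⟩
      y + countN (climb (suc e) y hs)                            ≡⟨ countN-climb (≤-trans y≤re (*-monoʳ-≤ r (n≤1+n e))) dh ⟩
      r * (suc e + length hs)                                    ≡⟨ cong (r *_) (sym (+-suc e (length hs))) ⟩
      r * (e + suc (length hs))                                  ∎
      where open ≡-Reasoning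

    heightsFrom-climb : ∀ {e c hs} → DyckHeights e c hs → heightsFrom c (climb e c hs) ≡ hs
    heightsFrom-climb {e} {c} [] =
      trans (cong (heightsFrom c) (sym (++-identityʳ (replicate (r * e ∸ c) N)))) (heightsFrom-Ns (r * e ∸ c) c [])
    heightsFrom-climb {e} {c} {y ∷ hs} (cons c≤y _ dh) = begin
      heightsFrom c (replicate (y ∸ c) N ++ E ∷ climb (suc e) y hs) ≡⟨ heightsFrom-Ns (y ∸ c) c _ ⟩
      heightsFrom (c + (y ∸ c)) (E ∷ climb (suc e) y hs)
        ≡⟨ cong (λ c → heightsFrom c (E ∷ climb (suc e) y hs)) (m+[n∸m]≡n c≤y) ⟩
      y ∷ heightsFrom y (climb (suc e) y hs)                       ≡⟨ cong (y ∷_) (heightsFrom-climb dh) ⟩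
      y ∷ hs                                                       ∎
      where open ≡-Reasoning

    neverAbove-climb : ∀ {e c hs} → c ≤ r * e → DyckHeights e c hs → NeverAbove e c (climb e c hs)
    neverAbove-climb {e} {c} c≤re [] =
      subst (NeverAbove e c) (++-identityʳ (replicate (r * e ∸ c) N)) (neverAbove-Ns (r * e ∸ c) top (neverAbove-[] top))
      where top = ≤-reflexive (m+[n∸m]≡n c≤re)
    neverAbove-climb {e} {c} {y ∷ hs} _ (cons c≤y y≤re dh) =
      neverAbove-Ns (y ∸ c) (subst (_≤ r * e) (sym (m+[n∸m]≡n c≤y)) y≤re)
        (subst (λ y′ → NeverAbove e y′ (E ∷ climb (suc e) y hs)) (sym (m+[n∸m]≡n c≤y))
          (neverAbove-E y≤re (neverAbove-climb (≤-trans y≤re (*-monoʳ-≤ r (n≤1+n e))) dh)))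

    dyckPath-with-heights : ∀ {n hs} → DyckHeights 0 0 hs → length hs ≡ n →
                            Σ Path λ P → IsDyck r n P × heights P ≡ hs
    dyckPath-with-heights {n} {hs} dh refl =
      climb 0 0 hs , (countE-climb 0 0 hs , countN-climb z≤n dh , neverAbove-climb z≤n dh) , heightsFrom-climb dh

    tabulate-dyckHeights : ∀ {n e c} (f : Fin n → ℕ) → (∀ i → c ≤ f i) →
                           (∀ i j → toℕ i ≤ toℕ j → f i ≤ f j) → (∀ i → f i ≤ r * (e + toℕ i)) →
                           DyckHeights e c (tabulate f)
    tabulate-dyckHeights {zero} f _ _ _ = []
    tabulate-dyckHeights {suc n} {e} f c≤f mono bound =
      cons (c≤f Fin.zero) (subst (λ w → f Fin.zero ≤ r * w) (+-identityʳ e) (bound Fin.zero))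
        (tabulate-dyckHeights (λ i → f (Fin.suc i)) (λ i → mono Fin.zero (Fin.suc i) z≤n)
          (λ i j i≤j → mono (Fin.suc i) (Fin.suc j) (s≤s i≤j))
          (λ i → subst (λ w → f (Fin.suc i) ≤ r * w) (+-suc e (toℕ i)) (bound (Fin.suc i))))

  nth : List ℕ → ℕ → ℕ
  nth []       _       = 0
  nth (y ∷ _)  zero    = y
  nth (_ ∷ hs) (suc j) = nth hs j

  tabulate-nth : ∀ {n} hs → length hs ≡ n → hs ≡ tabulate {n = n} (λ j → nth hs (toℕ j))
  tabulate-nth []       refl = refl
  tabulate-nth (y ∷ hs) refl = cong (y ∷_) (tabulate-nth hs refl)

  tabulate-injective : ∀ {n} {f g : Fin n → ℕ} → tabulate f ≡ tabulate g → ∀ i → f i ≡ g i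
  tabulate-injective {suc n} eq Fin.zero    = ∷-injectiveˡ eq
  tabulate-injective {suc n} eq (Fin.suc i) = tabulate-injective (∷-injectiveʳ eq) i

  module _ {r : ℕ} where

    dyckHeights-nth-mono : ∀ {e c hs} → DyckHeights r e c hs → ∀ j → suc j < length hs → nth hs j ≤ nth hs (suc j)
    dyckHeights-nth-mono (cons _ _ (cons y≤y′ _ _)) zero    _ = y≤y′
    dyckHeights-nth-mono (cons _ _ [])              zero    (s≤s ())
    dyckHeights-nth-mono (cons _ _ dh)              (suc j) j<len = dyckHeights-nth-mono dh j (s≤s⁻¹ j<len)

    dyckHeights-nth-bound : ∀ {e c hs} → DyckHeights r e c hs → ∀ j → j < length hs → nth hs j ≤ r * (e + j)
    dyckHeights-nth-bound {e} (cons _ y≤re _) zero _ = subst (λ w → _ ≤ r * w) (sym (+-identityʳ e)) y≤re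
    dyckHeights-nth-bound {e} {hs = _ ∷ hs} (cons _ _ dh) (suc j) j<len =
      subst (λ w → nth hs j ≤ r * w) (sym (+-suc e j)) (dyckHeights-nth-bound dh j (s≤s⁻¹ j<len))

module Realisation where

  open Arithmetic using (scaled; scaled-below⇔)
  open Counting
  open Regions
  open SortedPoints
  open import Data.Nat
    using (ℕ; zero; suc; _+_; _*_; _^_; _∸_; _≤_; _<_; _≤?_; _<?_; _≟_; z≤n; s≤s; s≤s⁻¹)
  open import Data.Nat.Properties
  open import Data.Nat.Solver using (module +-*-Solver)
  import Data.Rational.Properties as ℚ
  open import Data.Fin using (Fin; toℕ)
  import Data.Fin.Properties as Fin
  open import Data.List.Relation.Unary.All as All using (All)
  open import Data.List.Membership.Propositional using (_∈_)
  open import Data.Product using (_×_; _,_; Σ; ∃-syntax; proj₁; proj₂)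
  open import Data.Sum using (_⊎_; inj₁; inj₂)
  open import Function using (_∘_; _⇔_; mk⇔; Equivalence)
  open import Relation.Nullary using (yes; no; contradiction)
  open import Relation.Nullary.Decidable using (_×-dec_)
  open import Relation.Unary using (Decidable)
  open import Relation.Binary.Definitions using (tri<; tri≈; tri>)
  open import Relation.Binary.PropositionalEquality
    using (_≡_; _≢_; refl; sym; trans; cong; subst; subst₂; module ≡-Reasoning)

  discrete-ivt : (f : ℕ → ℕ) {t : ℕ} (S : ℕ) → f 0 ≤ t → t ≤ f S → (∀ s → f (suc s) ≤ suc (f s)) →
                 ∃[ s ] f s ≡ t
  discrete-ivt f zero    f0≤t t≤fS _ = 0 , ≤-antisym f0≤t t≤fS
  discrete-ivt f {t} (suc S) f0≤t t≤fS step with t ≤? f S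
  ... | yes t≤fS′ = discrete-ivt f S f0≤t t≤fS′ step
  ... | no  t≰fS′ = suc S , ≤-antisym (≤-trans (step S) (≰⇒> t≰fS′)) t≤fS

  _[_↦_] : (ℕ → ℕ) → ℕ → ℕ → ℕ → ℕ
  (f [ b ↦ v ]) i with i ≟ b
  ... | yes _ = v
  ... | no  _ = f i

  update-here : ∀ f b v → (f [ b ↦ v ]) b ≡ v
  update-here f b v with b ≟ b
  ... | yes _   = refl
  ... | no  b≢b = contradiction refl b≢b

  update-there : ∀ f {b} v {i} → i ≢ b → (f [ b ↦ v ]) i ≡ f i
  update-there f {b} v {i} i≢b with i ≟ b
  ... | yes i≡b = contradiction i≡b i≢b
  ... | no  _   = refl

  double-marker : ∀ p k u → 2 * p + k * (2 * u) ≡ 2 * (p + k * u)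
  double-marker = solve 3 (λ p k u → con 2 :* p :+ k :* (con 2 :* u) := con 2 :* (p :+ k :* u)) refl
    where open +-*-Solver

  2m<1+2v⇔m≤v : ∀ {m v} → 2 * m < suc (2 * v) ⇔ m ≤ v
  2m<1+2v⇔m≤v = mk⇔ (*-cancelˡ-≤ 2 ∘ s≤s⁻¹) (s≤s ∘ *-monoʳ-≤ 2)

  module _ (r n : ℕ) (H : ℕ → ℕ)
           (H-mono : ∀ j → suc j < n → H j ≤ H (suc j)) (H-bound : ∀ j → j < n → H j ≤ r * j) where

    MarkerBelow : (ℕ → ℕ) → ℕ → ℕ → ℕ → Fin n × ℕ → Set
    MarkerBelow pos U j t (i , k) = toℕ i < j × pos (toℕ i) + k * U < t

    markerBelow? : ∀ pos U j t → Decidable (MarkerBelow pos U j t)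
    markerBelow? pos U j t (i , k) = (toℕ i <? j) ×-dec (pos (toℕ i) + k * U <? t)

    -- The first b points scaled by -2^b: x_j sits at pos j and its marker x_j - k at pos j + k * 2^b.
    record Layout (b : ℕ) : Set where
      field
        pos        : ℕ → ℕ
        increasing : ∀ {i j} → i < j → j < b → pos i < pos j
        separated  : ∀ {i j} → i < j → j < b → ∀ {k} → k ≤ r → pos i + k * 2 ^ b ≢ pos j
        counts     : ∀ {j} → j < b → count (markerBelow? pos (2 ^ b) j (pos j)) (markers r n) ≡ H j

    pos-≤-last : ∀ {b} (L : Layout (suc b)) {i} → i < suc b → Layout.pos L i ≤ Layout.pos L b
    pos-≤-last {b} L i<1+b with m≤n⇒m<n∨m≡n (s≤s⁻¹ i<1+b)
    ... | inj₁ i<b  = <⇒≤ (Layout.increasing L i<b (n<1+n b))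
    ... | inj₂ refl = ≤-refl

    module _ {b} (L : Layout b) where
      open Layout L

      markers-apart : ∀ {i j k k′} → i < j → j < b → k ≤ r → pos i + k * 2 ^ b ≢ pos j + k′ * 2 ^ b
      markers-apart {i} {j} {k} {k′} i<j j<b k≤r eq with k ≤? k′
      ... | yes k≤k′ = <⇒≢ (+-mono-<-≤ (increasing i<j j<b) (*-monoˡ-≤ (2 ^ b) k≤k′)) eq
      ... | no  k≰k′ = separated i<j j<b (≤-trans (m∸n≤m k k′) k≤r) (+-cancelʳ-≡ (k′ * 2 ^ b) _ _ (begin
          pos i + (k ∸ k′) * 2 ^ b + k′ * 2 ^ b   ≡⟨ +-assoc (pos i) _ _ ⟩
          pos i + ((k ∸ k′) * 2 ^ b + k′ * 2 ^ b) ≡⟨ cong (pos i +_) (sym (*-distribʳ-+ (2 ^ b) (k ∸ k′) k′)) ⟩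
          pos i + (k ∸ k′ + k′) * 2 ^ b           ≡⟨ cong (λ k → pos i + k * 2 ^ b) (m∸n+n≡m (<⇒≤ (≰⇒> k≰k′))) ⟩
          pos i + k * 2 ^ b                       ≡⟨ eq ⟩
          pos j + k′ * 2 ^ b                      ∎))
        where open ≡-Reasoning

      marker-unique : ∀ {i i′ k k′} → i < b → i′ < b → k ≤ r → k′ ≤ r →
                      pos i + k * 2 ^ b ≡ pos i′ + k′ * 2 ^ b → i ≡ i′ × k ≡ k′
      marker-unique {i} {i′} {k} {k′} i<b i′<b k≤r k′≤r eq with <-cmp i i′
      ... | tri< i<i′ _ _ = contradiction eq (markers-apart {k′ = k′} i<i′ i′<b k≤r)
      ... | tri> _ _ i′<i = contradiction (sym eq) (markers-apart {k′ = k} i′<i i<b k′≤r)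
      ... | tri≈ _ refl _ = refl , *-cancelʳ-≡ k k′ (2 ^ b) {{m^n≢0 2 b}} (+-cancelˡ-≡ (pos i) (k * 2 ^ b) (k′ * 2 ^ b) eq)

    -- Doubling positions and unit puts all old points and markers on even positions, so the new point
    -- can go to any odd position 2v+1, below which lie the G v markers at most v; as G grows by at
    -- most one per step, the discrete intermediate value theorem gives G v = H b.
    module Extension {b} (b<n : b < n) (L : Layout b) where
      open Layout L

      private
        U : ℕ
        U = 2 ^ b

      AtMost : ℕ → Fin n × ℕ → Set
      AtMost v (i , k) = toℕ i < b × pos (toℕ i) + k * U ≤ v

      atMost? : ∀ v → Decidable (AtMost v)
      atMost? v (i , k) = (toℕ i <? b) ×-dec (pos (toℕ i) + k * U ≤? v)

      AtExactly : ℕ → Fin n × ℕ → Set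
      AtExactly v (i , k) = toℕ i < b × pos (toℕ i) + k * U ≡ v

      atExactly? : ∀ v → Decidable (AtExactly v)
      atExactly? v (i , k) = (toℕ i <? b) ×-dec (pos (toℕ i) + k * U ≟ v)

      G : ℕ → ℕ
      G v = count (atMost? v) (markers r n)

      G-step : ∀ v → G (suc v) ≤ suc (G v)
      G-step v = begin
        G (suc v)
          ≤⟨ count-∪ (atMost? v) (atMost? (suc v)) (atExactly? (suc v)) (All.universal split (markers r n)) ⟩
        G v + count (atExactly? (suc v)) (markers r n)
          ≤⟨ +-monoʳ-≤ (G v) (count-≤1 (atExactly? (suc v)) (markers-unique r n) at-most-one) ⟩
        G v + 1
          ≡⟨ +-comm (G v) 1 ⟩
        suc (G v) ∎
        where
        open ≤-Reasoning
        split : ∀ p → AtMost (suc v) p → AtMost v p ⊎ AtExactly (suc v) p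
        split (i , k) (i<b , ≤1+v) with m≤n⇒m<n∨m≡n ≤1+v
        ... | inj₁ <1+v = inj₁ (i<b , s≤s⁻¹ <1+v)
        ... | inj₂ ≡1+v = inj₂ (i<b , ≡1+v)
        at-most-one : ∀ {p q} → p ∈ markers r n → q ∈ markers r n → AtExactly (suc v) p → AtExactly (suc v) q → p ≡ q
        at-most-one {i , k} {i′ , k′} p∈ q∈ (i<b , eq) (i′<b , eq′)
          with toℕi≡ , refl ←
                 marker-unique L i<b i′<b (proj₂ (∈markers⁻ p∈)) (proj₂ (∈markers⁻ q∈)) (trans eq (sym eq′))
          = cong (_, k) (Fin.toℕ-injective toℕi≡)

      module _ (v₀ : ℕ) (pos≤v₀ : ∀ {i} → i < b → pos i ≤ v₀) (G-start : G v₀ ≤ H b) where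

        G-end : H b ≤ G (v₀ + r * U)
        G-end = begin
          H b
            ≤⟨ H-bound b b<n ⟩
          r * b
            ≡⟨ sym (count-markers-below r b (<⇒≤ b<n)) ⟩
          count ((λ i → toℕ i <? b) ∘ proj₁) (markers r n)
            ≤⟨ count-mono ((λ i → toℕ i <? b) ∘ proj₁) (atMost? (v₀ + r * U)) (All.tabulate below-end) ⟩
          G (v₀ + r * U) ∎
          where
          open ≤-Reasoning
          below-end : ∀ {p} → p ∈ markers r n → toℕ (proj₁ p) < b → AtMost (v₀ + r * U) p
          below-end {i , k} p∈ i<b = i<b , +-mono-≤ (pos≤v₀ i<b) (*-monoˡ-≤ U (proj₂ (∈markers⁻ p∈)))

        private
          threshold : ∃[ s ] G (v₀ + s) ≡ H b
          threshold = discrete-ivt (λ s → G (v₀ + s)) (r * U)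
            (subst (λ w → G w ≤ H b) (sym (+-identityʳ v₀)) G-start) G-end
            (λ s → subst (λ w → G w ≤ suc (G (v₀ + s))) (sym (+-suc v₀ s)) (G-step (v₀ + s)))

          v : ℕ
          v = v₀ + proj₁ threshold

          pos≤v : ∀ {i} → i < b → pos i ≤ v
          pos≤v i<b = ≤-trans (pos≤v₀ i<b) (m≤m+n v₀ _)

          pos′ : ℕ → ℕ
          pos′ = (λ i → 2 * pos i) [ b ↦ suc (2 * v) ]

          pos′-old : ∀ {i} → i < b → pos′ i ≡ 2 * pos i
          pos′-old i<b = update-there (λ i → 2 * pos i) (suc (2 * v)) (<⇒≢ i<b)

          pos′-new : pos′ b ≡ suc (2 * v)
          pos′-new = update-here (λ i → 2 * pos i) b (suc (2 * v))

          old-or-new : ∀ {j} → j < suc b → j < b ⊎ j ≡ b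
          old-or-new = m≤n⇒m<n∨m≡n ∘ s≤s⁻¹

          increasing′ : ∀ {i j} → i < j → j < suc b → pos′ i < pos′ j
          increasing′ {i} {j} i<j j≤b with old-or-new j≤b
          ... | inj₁ j<b rewrite pos′-old (<-trans i<j j<b) | pos′-old j<b = *-monoʳ-< 2 (increasing i<j j<b)
          ... | inj₂ refl rewrite pos′-old i<j | pos′-new = s≤s (*-monoʳ-≤ 2 (pos≤v i<j))

          separated′ : ∀ {i j} → i < j → j < suc b → ∀ {k} → k ≤ r → pos′ i + k * (2 * U) ≢ pos′ j
          separated′ {i} {j} i<j j≤b {k} k≤r with old-or-new j≤b
          ... | inj₁ j<b rewrite pos′-old (<-trans i<j j<b) | pos′-old j<b | double-marker (pos i) k U =
                separated i<j j<b k≤r ∘ *-cancelˡ-≡ _ _ 2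
          ... | inj₂ refl rewrite pos′-old i<j | pos′-new | double-marker (pos i) k U = even≢odd (pos i + k * U) v

          doubled : ∀ {i} k → i < b → pos′ i + k * (2 * U) ≡ 2 * (pos i + k * U)
          doubled {i} k i<b = trans (cong (_+ k * (2 * U)) (pos′-old i<b)) (double-marker (pos i) k U)

          counts′ : ∀ {j} → j < suc b → count (markerBelow? pos′ (2 * U) j (pos′ j)) (markers r n) ≡ H j
          counts′ {j} j≤b with old-or-new j≤b
          ... | inj₁ j<b = trans (count-cong (markerBelow? pos′ (2 * U) j (pos′ j)) (markerBelow? pos U j (pos j))
                                   (All.universal halve (markers r n)) (All.universal double (markers r n)))
                                 (counts j<b)
            where
            halve : ∀ p → MarkerBelow pos′ (2 * U) j (pos′ j) p → MarkerBelow pos U j (pos j) p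
            halve (i , k) (i<j , below) =
              i<j , *-cancelˡ-< 2 _ _ (subst₂ _<_ (doubled k (<-trans i<j j<b)) (pos′-old j<b) below)
            double : ∀ p → MarkerBelow pos U j (pos j) p → MarkerBelow pos′ (2 * U) j (pos′ j) p
            double (i , k) (i<j , below) =
              i<j , subst₂ _<_ (sym (doubled k (<-trans i<j j<b))) (sym (pos′-old j<b)) (*-monoʳ-< 2 below)
          ... | inj₂ refl = trans (count-cong (markerBelow? pos′ (2 * U) b (pos′ b)) (atMost? v)
                                    (All.universal to-atMost (markers r n)) (All.universal from-atMost (markers r n)))
                                  (proj₂ threshold)
            where
            to-atMost : ∀ p → MarkerBelow pos′ (2 * U) b (pos′ b) p → AtMost v p
            to-atMost (i , k) (i<b , below) =
              i<b , Equivalence.to 2m<1+2v⇔m≤v (subst₂ _<_ (doubled k i<b) pos′-new below)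
            from-atMost : ∀ p → AtMost v p → MarkerBelow pos′ (2 * U) b (pos′ b) p
            from-atMost (i , k) (i<b , ≤v) =
              i<b , subst₂ _<_ (sym (doubled k i<b)) (sym pos′-new) (Equivalence.from 2m<1+2v⇔m≤v ≤v)

        extended : Layout (suc b)
        extended = record { pos = pos′ ; increasing = increasing′ ; separated = separated′ ; counts = counts′ }

    extend : ∀ {b} → b < n → Layout b → Layout (suc b)
    extend {zero} 0<n L = Extension.extended 0<n L 0 (λ ()) (≤-trans (≤-reflexive none) z≤n)
      where
      none : Extension.G 0<n L 0 ≡ 0
      none = count-none (Extension.atMost? 0<n L 0) (All.universal (λ _ ()) (markers r n))
    extend {suc b} b<n L = Extension.extended b<n L (pos b) (pos-≤-last L) G-start
      where
      open Layout L
      U : ℕ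
      U = 2 ^ suc b
      G-start : Extension.G b<n L (pos b) ≤ H (suc b)
      G-start = begin
        Extension.G b<n L (pos b)                           ≤⟨ count-mono (Extension.atMost? b<n L (pos b)) (markerBelow? pos U b (pos b))
                                                                           (All.tabulate below-last) ⟩
        count (markerBelow? pos U b (pos b)) (markers r n)  ≡⟨ counts (n<1+n b) ⟩
        H b                                                 ≤⟨ H-mono b b<n ⟩
        H (suc b)                                           ∎
        where
        open ≤-Reasoning
        below-last : ∀ {p} → p ∈ markers r n → Extension.AtMost b<n L (pos b) p → MarkerBelow pos U b (pos b) p
        below-last {i , zero}   p∈ _ = contradiction (proj₁ (∈markers⁻ p∈)) λ ()
        below-last {i , suc k′} p∈ (i≤b , ≤last) with m≤n⇒m<n∨m≡n (s≤s⁻¹ i≤b)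
        ... | inj₁ i<b  = i<b , ≤∧≢⇒< ≤last (separated i<b (n<1+n b) (proj₂ (∈markers⁻ p∈)))
        ... | inj₂ refl = contradiction ≤last (<⇒≱ (m<m+n (pos b) (<-≤-trans (m^n>0 2 (suc b)) (m≤m+n U _))))

    layout : ∀ b → b ≤ n → Layout b
    layout zero    _   = record { pos = λ _ → 0 ; increasing = λ _ () ; separated = λ _ () ; counts = λ () }
    layout (suc b) b<n = extend b<n (layout b (<⇒≤ b<n))

    module _ (L : Layout n) where
      open Layout L

      private
        U : ℕ
        U = 2 ^ n

      point : Point n
      point j = scaled U {{m^n≢0 2 n}} (pos (toℕ j))

      point-below⇔ : ∀ a b k k′ → Below point a k b k′ ⇔ pos (toℕ b) + k * U < pos (toℕ a) + k′ * U
      point-below⇔ a b = scaled-below⇔ U {{m^n≢0 2 n}} (pos (toℕ a)) (pos (toℕ b))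

      point-decreasing : Decreasing point
      point-decreasing a b a<b = Equivalence.to (below-0⇔< point b a)
        (Equivalence.from (point-below⇔ b a 0 0) (+-monoˡ-< 0 (increasing a<b (Fin.toℕ<n b))))

      point-distinct : ShiftsDistinct r point
      point-distinct a b a≢b k k′ k≤r k′≤r eq with <-cmp (pos (toℕ b) + k * U) (pos (toℕ a) + k′ * U)
      ... | tri< lt _ _ = ℚ.<⇒≢ (Equivalence.from (point-below⇔ a b k k′) lt) eq
      ... | tri> _ _ gt = ℚ.<⇒≢ (Equivalence.from (point-below⇔ b a k′ k) gt) (sym eq)
      ... | tri≈ _ same _ =
        a≢b (sym (Fin.toℕ-injective (proj₁ (marker-unique L (Fin.toℕ<n b) (Fin.toℕ<n a) k≤r k′≤r same))))

      private
        counted⇔marker-below : ∀ j i k → Counted point j (i , k) ⇔ pos (toℕ i) + k * U < pos (toℕ j)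
        counted⇔marker-below j i k = mk⇔
            (subst (pos (toℕ i) + k * U <_) (+-identityʳ _) ∘ Equivalence.to (point-below⇔ j i k 0)
               ∘ Equivalence.to (counted⇔below point i j k))
            (Equivalence.from (counted⇔below point i j k) ∘ Equivalence.from (point-below⇔ j i k 0)
               ∘ subst (pos (toℕ i) + k * U <_) (sym (+-identityʳ _)))

        to-marker : ∀ j p → Counted point j p → MarkerBelow pos U (toℕ j) (pos (toℕ j)) p
        to-marker j (i , k) counted =
            below⇒index< point-decreasing {i} {j} {k} (Equivalence.to (counted⇔below point i j k) counted) ,
            Equivalence.to (counted⇔marker-below j i k) counted

        from-marker : ∀ j p → MarkerBelow pos U (toℕ j) (pos (toℕ j)) p → Counted point j p
        from-marker j (i , k) (_ , below) = Equivalence.from (counted⇔marker-below j i k) below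

      point-heights : ∀ j → h r point j ≡ H (toℕ j)
      point-heights j = trans
        (count-cong (counted? point j) (markerBelow? pos U (toℕ j) (pos (toℕ j)))
          (All.universal (to-marker j) (markers r n)) (All.universal (from-marker j) (markers r n)))
        (counts (Fin.toℕ<n j))

    realise : Σ (Point n) λ y → Decreasing y × ShiftsDistinct r y × (∀ j → h r y j ≡ H (toℕ j))
    realise = point L , point-decreasing L , point-distinct L , point-heights L
      where
      L : Layout n
      L = layout n ≤-refl

open import Data.Nat using (ℕ; _≤_)
open import Data.Fin using (Fin)
open import Data.Product using (_×_; Σ; ∃; _,_)
open import Data.Fin.Permutation using (Permutation′; _⟨$⟩ʳ_)
open import Relation.Binary.PropositionalEquality using (_≡_)

open import Data.Nat as ℕ using (suc; z≤n)
open import Data.Fin.Permutation using (_⟨$⟩ˡ_; inverseˡ; inverseʳ; flip)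
open import Data.List using (List; length)
open import Data.List.Properties using (tabulate-cong; length-tabulate)
open import Function using (_∘_; Injection)
open import Function.Properties.Inverse using (↔⇒↣)
open import Relation.Binary.PropositionalEquality using (sym; trans; cong; subst)

open Regions
open Sorting
open SortedPoints
open DyckPaths
open Realisation

module _ (r n : ℕ) where

  sameRegion⇒sameSortingAndHeights : ∀ (x y : Point n) → InComplement r n x → InComplement r n y →
       SameRegion r n x y → ∀ (σ : Permutation′ n) → Sorts σ x →
       Sorts σ y × hseq r (act σ x) ≡ hseq r (act σ y)
  sameRegion⇒sameSortingAndHeights x y inC-x inC-y same σ x-sorted =
    decreasing-cong r {x = act σ x} {act σ y} σx⇒σy x-sorted ,
    tabulate-cong (h-cong r {x = act σ x} {act σ y} σx⇒σy σy⇒σx)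
    where
    σx⇒σy : PreservesBelow r (act σ x) (act σ y)
    σx⇒σy = preservesBelow-∘ r {x = x} {y} (σ ⟨$⟩ʳ_) (sameRegion⇒preservesBelow r {x = x} {y} inC-y same)
    σy⇒σx : PreservesBelow r (act σ y) (act σ x)
    σy⇒σx = preservesBelow-∘ r {x = y} {x} (σ ⟨$⟩ʳ_)
              (sameRegion⇒preservesBelow r {x = y} {x} inC-x (sameRegion-sym {x = x} {y} same))

  region⇒dyckPath : ∀ (x : Point n) → InComplement r n x →
       Σ (Permutation′ n) λ σ → Sorts σ x × Σ Path λ P → IsDyck r n P × heights P ≡ hseq r (act σ x)
  region⇒dyckPath x inC = σ , sorted , dyckPath-with-heights r
      (tabulate-dyckHeights r (h r (act σ x)) (λ _ → z≤n) (λ i j → h-monotone sorted r {i} {j}) (h-bounded sorted r))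
      (length-tabulate (h r (act σ x)))
    where
    x-injective : ∀ {i j} → x i ≡ x j → i ≡ j
    x-injective = shiftsDistinct⇒injective r {x = x} (inComplement⇒shiftsDistinct r {x = x} inC)
    σ : Permutation′ n
    σ = sortingPermutation x x-injective
    sorted : Decreasing (act σ x)
    sorted = sortingPermutation-sorts x x-injective

  sameHeights⇒sameRegion : ∀ (x y : Point n) → InComplement r n x → InComplement r n y →
       ∀ (σ : Permutation′ n) (P : Path) → Sorts σ x → Sorts σ y →
       heights P ≡ hseq r (act σ x) → heights P ≡ hseq r (act σ y) → SameRegion r n x y
  sameHeights⇒sameRegion x y inC-x inC-y σ P x-sorted y-sorted x-heights y-heights =
    preservesBelow⇒sameRegion r {x = x} {y} (unpermute x y σx⇒σy) (unpermute y x σy⇒σx)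
    where
    same-h : ∀ j → h r (act σ x) j ≡ h r (act σ y) j
    same-h = tabulate-injective (trans (sym x-heights) y-heights)
    distinct : ∀ z → InComplement r n z → ShiftsDistinct r (act σ z)
    distinct z inC = shiftsDistinct-∘ r {x = z} (Injection.injective (↔⇒↣ σ)) (inComplement⇒shiftsDistinct r {x = z} inC)
    σx⇒σy : PreservesBelow r (act σ x) (act σ y)
    σx⇒σy = preservesBelow-from-heights r x-sorted y-sorted (distinct x inC-x) (distinct y inC-y) same-h
    σy⇒σx : PreservesBelow r (act σ y) (act σ x)
    σy⇒σx = preservesBelow-from-heights r y-sorted x-sorted (distinct y inC-y) (distinct x inC-x) (sym ∘ same-h)
    unpermute : ∀ u v → PreservesBelow r (act σ u) (act σ v) → PreservesBelow r u v
    unpermute u v = preservesBelow-resp r {x = act σ u ∘ (σ ⟨$⟩ˡ_)} {u} {act σ v ∘ (σ ⟨$⟩ˡ_)} {v}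
                      (λ _ → cong u (inverseʳ σ)) (λ _ → cong v (inverseʳ σ))
                  ∘ preservesBelow-∘ r {x = act σ u} {act σ v} (σ ⟨$⟩ˡ_)

  permute-decreasing : ∀ (σ : Permutation′ n) (y : Point n) → Decreasing y → ShiftsDistinct r y →
       Σ (Point n) λ x → InComplement r n x × Sorts σ x × hseq r y ≡ hseq r (act σ x)
  permute-decreasing σ y y↓ y-distinct = x , inC , sorted , tabulate-cong (h-cong r {x = y} {act σ x} y⇒σx σx⇒y)
    where
    x : Point n
    x i = y (σ ⟨$⟩ˡ i)
    y≗σx : ∀ a → y a ≡ act σ x a
    y≗σx a = cong y (sym (inverseˡ σ))
    y⇒σx : PreservesBelow r y (act σ x)
    y⇒σx = preservesBelow-≗ r {x = y} {act σ x} y≗σx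
    σx⇒y : PreservesBelow r (act σ x) y
    σx⇒y = preservesBelow-≗ r {x = act σ x} {y} (sym ∘ y≗σx)
    inC : InComplement r n x
    inC = shiftsDistinct⇒inComplement r {x = x}
            (shiftsDistinct-∘ r {x = y} {f = σ ⟨$⟩ˡ_} (Injection.injective (↔⇒↣ (flip σ))) y-distinct)
    sorted : Sorts σ x
    sorted = decreasing-cong r {x = y} {act σ x} y⇒σx y↓

  dyckPath⇒region : ∀ (σ : Permutation′ n) (P : Path) → IsDyck r n P →
       Σ (Point n) λ x → InComplement r n x × Sorts σ x × heights P ≡ hseq r (act σ x)
  dyckPath⇒region σ P (#E , _ , never-above) =
    let y , y↓ , y-distinct , y-heights = realise r n (nth hs) mono bound
        x , inC , sorted , same-heights = permute-decreasing σ y y↓ y-distinct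
    in  x , inC , sorted , trans (trans (tabulate-nth hs len) (tabulate-cong (sym ∘ y-heights))) same-heights
    where
    hs : List ℕ
    hs = heights P
    dh : DyckHeights r 0 0 hs
    dh = neverAbove⇒dyckHeights r P never-above
    len : length hs ≡ n
    len = trans (length-heightsFrom 0 P) #E
    mono : ∀ j → suc j ℕ.< n → nth hs j ≤ nth hs (suc j)
    mono j j+1<n = dyckHeights-nth-mono dh j (subst (suc j ℕ.<_) (sym len) j+1<n)
    bound : ∀ j → j ℕ.< n → nth hs j ≤ r ℕ.* j
    bound j j<n = dyckHeights-nth-bound dh j (subst (j ℕ.<_) (sym len) j<n)

theorem2p6 : (r n : ℕ) → 1 ≤ r → 1 ≤ n →
    -- π_Δ is unique
    (∀ (x : Point n) → InComplement r n x → ∀ (σ τ : Permutation′ n) →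
       Sorts σ x → Sorts τ x → ∀ i → σ ⟨$⟩ʳ i ≡ τ ⟨$⟩ʳ i)
    -- π_Δ and h(π_Δ(Δ)) do not depend on the point chosen in Δ
    × (∀ (x y : Point n) → InComplement r n x → InComplement r n y →
       SameRegion r n x y → ∀ (σ : Permutation′ n) → Sorts σ x →
       Sorts σ y × hseq r (act σ x) ≡ hseq r (act σ y))
    -- a height sequence determines the r-Dyck path
    × (∀ (P Q : Path) → IsDyck r n P → IsDyck r n Q → heights P ≡ heights Q → P ≡ Q)
    -- Φ is defined: π_Δ exists and h(π_Δ(Δ)) is the height sequence of an r-Dyck path
    × (∀ (x : Point n) → InComplement r n x →
       Σ (Permutation′ n) λ σ → Sorts σ x ×
         Σ Path λ P → IsDyck r n P × heights P ≡ hseq r (act σ x))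
    -- Φ is injective
    × (∀ (x y : Point n) → InComplement r n x → InComplement r n y →
       ∀ (σ : Permutation′ n) (P : Path) → Sorts σ x → Sorts σ y →
       heights P ≡ hseq r (act σ x) → heights P ≡ hseq r (act σ y) →
       SameRegion r n x y)
    -- Φ is surjective
    × (∀ (σ : Permutation′ n) (P : Path) → IsDyck r n P →
       Σ (Point n) λ x → InComplement r n x × Sorts σ x × heights P ≡ hseq r (act σ x))
theorem2p6 r n _ _ =
  (λ x _ σ τ → sorting-unique {σ = σ} {τ} {x}) ,
  sameRegion⇒sameSortingAndHeights r n ,
  dyckPath-heights-injective {r} ,
  region⇒dyckPath r n ,
  sameHeights⇒sameRegion r n ,
  dyckPath⇒region r n
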